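{- For every integer $n \geq 10$, \[ \widetilde{P}_n(X) = X^{n-1} + X^{n-2} - (n-2) X^{n-3} - (n-3) X^{n-4} + \frac{(n-3)(n-4)}{2} X^{n-5} + \frac{(n-4)(n-5)}{2} X^{n-6} + R(X), \] where $R(X)$ is a polynomial of degree $\leq n-7$.
   Context: $\widetilde{P}_n(X)\in\mathbb{Z}[X]$ (for $n\ge 1$) is the polynomial of degree $n-1$ determined by the formal power series identity $1 + (X - 2) \sum_{n\geq 1} \widetilde{P}_n (X)\, t^n = \prod_{i\geq 1} \frac{(1-t^i)^2}{1- X t^i + t^{2i}}$. Equivalently $\widetilde{P}_n(q+q^{ -1}) = P_n(q)/q^{n-1}$ where $P_n(q)=C_n(q)/(q-1)^2$ and $C_n(q)$ counts ideals of codimension $n$ in $\mathbb{F}_q[x,y,x^{ -1},y^{ -1}]$. -}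

module Defs where

open import Data.Nat using (ℕ; zero; suc; _∸_; _≟_)
open import Data.Integer using (ℤ; +_; _+_; _*_; -_)
open import Data.List using (List; []; _∷_; _++_; [_])
open import Relation.Nullary using (yes; no)
open import Relation.Binary.PropositionalEquality using (_≡_)

-- Formal power series in X over ℤ (ℤ[X] ⊂ ℤ[[X]]): coefficient of X^k.

Poly : Set
Poly = ℕ → ℤ

0P : Poly
0P _ = + 0

1P : Poly
1P zero    = + 1
1P (suc _) = + 0

XP : Poly
XP (suc zero) = + 1
XP _          = + 0

_+P_ : Poly → Poly → Poly
(f +P g) k = f k + g k

-P_ : Poly → Poly
(-P f) k = - f k

_-P_ : Poly → Poly → Poly
f -P g = f +P (-P g)

sumℤ : ℕ → (ℕ → ℤ) → ℤ
sumℤ zero    f = + 0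
sumℤ (suc n) f = sumℤ n f + f n

sumP : ℕ → (ℕ → Poly) → Poly
sumP n f k = sumℤ n (λ j → f j k)

_*P_ : Poly → Poly → Poly
(f *P g) k = sumℤ (suc k) (λ j → f j * g (k ∸ j))

-- Formal power series in t with coefficients in ℤ[[X]]: coefficient of t^m.

Series : Set
Series = ℕ → Poly

constS : Poly → Series
constS p zero    = p
constS p (suc _) = 0P

1S : Series
1S = constS 1P

_+S_ : Series → Series → Series
(A +S B) m = A m +P B m

-S_ : Series → Series
(-S A) m = -P (A m)

_-S_ : Series → Series → Series
A -S B = A +S (-S B)

_*S_ : Series → Series → Series
(A *S B) m = sumP (suc m) (λ j → A j *P B (m ∸ j))

tPow : ℕ → Series
tPow i m with m ≟ i
... | yes _ = 1P
... | no  _ = 0P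

lookup0 : List Poly → ℕ → Poly
lookup0 []       _       = 0P
lookup0 (p ∷ ps) zero    = p
lookup0 (p ∷ ps) (suc n) = lookup0 ps n

-- Multiplicative inverse of a power series A with constant term 1:
-- g_0 = 1,  g_m = - Σ_{j=1}^{m} A_j g_{m-j}.
-- invList A m = [g_0, …, g_m].
invList : Series → ℕ → List Poly
invList A zero    = [ 1P ]
invList A (suc m) =
  invList A m ++
  [ -P (sumP (suc m) (λ j → A (suc j) *P lookup0 (invList A m) (m ∸ j))) ]

invS : Series → Series
invS A m = lookup0 (invList A m) m

denom : ℕ → Series
denom i = (1S -S (constS XP *S tPow i)) +S tPow (i Data.Nat.+ i)

factor : ℕ → Series
factor i = ((1S -S tPow i) *S (1S -S tPow i)) *S invS (denom i)

prodTo : ℕ → Series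
prodTo zero    = 1S
prodTo (suc N) = prodTo N *S factor (suc N)

-- coefficient of t^m in the infinite product: factors with i > m are
-- ≡ 1 mod t^{m+1}, so it equals the coefficient in ∏_{i=1}^{m}.
infProd : Series
infProd m = prodTo m m

genS : (ℕ → Poly) → Series
genS P zero    = 0P
genS P (suc n) = P (suc n)

lhs : (ℕ → Poly) → Series
lhs P = 1S +S (constS (XP -P (1P +P 1P)) *S genS P)

IsPtilde : (ℕ → Poly) → Set
IsPtilde P = ∀ m k → lhs P m k ≡ infProd m k

module Submission where

-- Write u = t and v = tX. The i-th factor of the product is 1 + O(u^(i-1)), so modulo u^6 only
-- the factors with i ≤ 6 matter; multiplying by their denominators gives a polynomial identity,
-- from which the coefficients of u^d v^e (d ≤ 5) are obtained in closed form by cancellation.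
-- Writing P̃_n[k] for the coefficient of X^k, comparing coefficients of t^n X^(k+1) in the
-- defining identity gives P̃_n[k] = [t^n X^(k+1)] ∏ + 2 P̃_n[k+1]. For k ≥ n the product term
-- vanishes, and an integer sequence with f_k = 2 f_(k+1) is zero; six steps down from k = n,
-- which read the product only at u^d with d ≤ 5, give the stated coefficients.

open import Algebra using (CommutativeRing)
open import Algebra.Core using (Op₁; Op₂)
open import Data.Nat as ℕ using (ℕ; zero; suc; _∸_; _<_)
import Data.Nat.Properties as ℕ
open import Data.Product using (_,_)
open import Data.Sum using (inj₁; inj₂)
open import Function using (_∘_)
open import Relation.Binary.PropositionalEquality as ≡ using (_≡_; _≢_)
import Relation.Binary.Reasoning.Setoid as SetoidReasoning
import Algebra.Properties.CommutativeSemigroup as CommutativeSemigroupProperties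

module FormalPowerSeries {c ℓ} (R : CommutativeRing c ℓ) where

  open CommutativeRing R
  open SetoidReasoning setoid
  open CommutativeSemigroupProperties +-commutativeSemigroup using (interchange)

  ∑ : ℕ → (ℕ → Carrier) → Carrier
  ∑ zero    f = 0#
  ∑ (suc n) f = ∑ n f + f n

  ∑-cong : ∀ n {f g : ℕ → Carrier} → (∀ j → j < n → f j ≈ g j) → ∑ n f ≈ ∑ n g
  ∑-cong zero    f≈g = refl
  ∑-cong (suc n) f≈g = +-cong (∑-cong n (λ j j<n → f≈g j (ℕ.m<n⇒m<1+n j<n))) (f≈g n ℕ.≤-refl)

  ∑-zero : ∀ n {f : ℕ → Carrier} → (∀ j → j < n → f j ≈ 0#) → ∑ n f ≈ 0#
  ∑-zero n {f} f≈0 = trans (∑-cong n f≈0) (∑-const0 n)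
    where
    ∑-const0 : ∀ n → ∑ n (λ _ → 0#) ≈ 0#
    ∑-const0 zero    = refl
    ∑-const0 (suc n) = trans (+-identityʳ _) (∑-const0 n)

  ∑-distrib-+ : ∀ n (f g : ℕ → Carrier) → ∑ n (λ j → f j + g j) ≈ ∑ n f + ∑ n g
  ∑-distrib-+ zero    f g = sym (+-identityˡ 0#)
  ∑-distrib-+ (suc n) f g = begin
    ∑ n (λ j → f j + g j) + (f n + g n) ≈⟨ +-congʳ (∑-distrib-+ n f g) ⟩
    (∑ n f + ∑ n g) + (f n + g n)       ≈⟨ interchange _ _ _ _ ⟩
    (∑ n f + f n) + (∑ n g + g n)       ∎

  ∑-distribˡ-* : ∀ n a (f : ℕ → Carrier) → a * ∑ n f ≈ ∑ n (λ j → a * f j)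
  ∑-distribˡ-* zero    a f = zeroʳ a
  ∑-distribˡ-* (suc n) a f = trans (distribˡ a _ _) (+-congʳ (∑-distribˡ-* n a f))

  ∑-head : ∀ n (f : ℕ → Carrier) → ∑ (suc n) f ≈ f 0 + ∑ n (f ∘ suc)
  ∑-head zero    f = trans (+-identityˡ _) (sym (+-identityʳ _))
  ∑-head (suc n) f = trans (+-congʳ (∑-head n f)) (+-assoc _ _ _)

  ∑-split : ∀ a b (f : ℕ → Carrier) → ∑ (a ℕ.+ b) f ≈ ∑ a f + ∑ b (λ i → f (a ℕ.+ i))
  ∑-split zero    b f = sym (+-identityˡ _)
  ∑-split (suc a) b f = begin
    ∑ (suc (a ℕ.+ b)) f                                   ≈⟨ ∑-head (a ℕ.+ b) f ⟩
    f 0 + ∑ (a ℕ.+ b) (f ∘ suc)                           ≈⟨ +-congˡ (∑-split a b (f ∘ suc)) ⟩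
    f 0 + (∑ a (f ∘ suc) + ∑ b (λ i → f (suc a ℕ.+ i)))   ≈⟨ sym (+-assoc _ _ _) ⟩
    (f 0 + ∑ a (f ∘ suc)) + ∑ b (λ i → f (suc a ℕ.+ i))   ≈⟨ +-congʳ (sym (∑-head a f)) ⟩
    ∑ (suc a) f + ∑ b (λ i → f (suc a ℕ.+ i))             ∎

  ∑-comm : ∀ n m (f : ℕ → ℕ → Carrier) →
           ∑ n (λ i → ∑ m (f i)) ≈ ∑ m (λ j → ∑ n (λ i → f i j))
  ∑-comm zero    m f = sym (∑-zero m (λ _ _ → refl))
  ∑-comm (suc n) m f = trans (+-congʳ (∑-comm n m f)) (sym (∑-distrib-+ m _ _))

  ∑-reverse : ∀ n (f : ℕ → Carrier) → ∑ (suc n) f ≈ ∑ (suc n) (λ j → f (n ∸ j))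
  ∑-reverse zero    f = refl
  ∑-reverse (suc n) f = begin
    ∑ (suc n) f + f (suc n)                 ≈⟨ +-congʳ (∑-reverse n f) ⟩
    ∑ (suc n) (λ j → f (n ∸ j)) + f (suc n) ≈⟨ +-comm _ _ ⟩
    f (suc n) + ∑ (suc n) (λ j → f (n ∸ j)) ≈⟨ sym (∑-head (suc n) (λ j → f (suc n ∸ j))) ⟩
    ∑ (suc (suc n)) (λ j → f (suc n ∸ j))   ∎

  ∑-single : ∀ n a (f : ℕ → Carrier) → a < n → (∀ j → j < n → j ≢ a → f j ≈ 0#) →
             ∑ n f ≈ f a
  ∑-single (suc n) a f a<1+n f≈0 with ℕ.m≤n⇒m<n∨m≡n (ℕ.≤-pred a<1+n)
  ... | inj₁ a<n = begin
    ∑ n f + f n ≈⟨ +-congˡ (f≈0 n ℕ.≤-refl (λ n≡a → ℕ.<-irrefl (≡.sym n≡a) a<n)) ⟩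
    ∑ n f + 0#  ≈⟨ +-identityʳ _ ⟩
    ∑ n f       ≈⟨ ∑-single n a f a<n (λ j j<n → f≈0 j (ℕ.m<n⇒m<1+n j<n)) ⟩
    f a         ∎
  ... | inj₂ ≡.refl = begin
    ∑ n f + f n ≈⟨ +-congʳ (∑-zero n λ j j<n → f≈0 j (ℕ.m<n⇒m<1+n j<n) (λ j≡n → ℕ.<-irrefl j≡n j<n)) ⟩
    0# + f n    ≈⟨ +-identityˡ _ ⟩
    f n         ∎

  PowerSeries : Set c
  PowerSeries = ℕ → Carrier

  _≈ₚ_ : PowerSeries → PowerSeries → Set ℓ
  f ≈ₚ g = ∀ k → f k ≈ g k

  1ₚ : PowerSeries
  1ₚ zero    = 1#
  1ₚ (suc _) = 0#

  _*ₚ_ : PowerSeries → PowerSeries → PowerSeries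
  (f *ₚ g) m = ∑ (suc m) (λ j → f j * g (m ∸ j))

  *ₚ-cong : ∀ {f f′ g g′} → f ≈ₚ f′ → g ≈ₚ g′ → (f *ₚ g) ≈ₚ (f′ *ₚ g′)
  *ₚ-cong f≈ g≈ m = ∑-cong (suc m) (λ j _ → *-cong (f≈ j) (g≈ (m ∸ j)))

  *ₚ-comm : ∀ f g → (f *ₚ g) ≈ₚ (g *ₚ f)
  *ₚ-comm f g m = trans (∑-reverse m _) (∑-cong (suc m) swap)
    where
    swap : ∀ j → j < suc m → f (m ∸ j) * g (m ∸ (m ∸ j)) ≈ g j * f (m ∸ j)
    swap j j≤m rewrite ℕ.m∸[m∸n]≡n (ℕ.≤-pred j≤m) = *-comm _ _

  *ₚ-suc : ∀ f g m → (f *ₚ g) (suc m) ≈ f 0 * g (suc m) + ((f ∘ suc) *ₚ g) m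
  *ₚ-suc f g m = ∑-head (suc m) _

  *ₚ-distribʳ : ∀ f g h → ((λ k → f k + g k) *ₚ h) ≈ₚ (λ k → (f *ₚ h) k + (g *ₚ h) k)
  *ₚ-distribʳ f g h m = trans (∑-cong (suc m) (λ j _ → distribʳ _ _ _)) (∑-distrib-+ (suc m) _ _)

  *ₚ-identityˡ : ∀ f → (1ₚ *ₚ f) ≈ₚ f
  *ₚ-identityˡ f zero    = trans (+-identityˡ _) (*-identityˡ _)
  *ₚ-identityˡ f (suc m) = begin
    (1ₚ *ₚ f) (suc m)                     ≈⟨ *ₚ-suc 1ₚ f m ⟩
    1# * f (suc m) + ((λ _ → 0#) *ₚ f) m  ≈⟨ +-cong (*-identityˡ _) (∑-zero (suc m) λ j _ → zeroˡ _) ⟩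
    f (suc m) + 0#                        ≈⟨ +-identityʳ _ ⟩
    f (suc m)                             ∎

  *ₚ-assoc : ∀ f g h → ((f *ₚ g) *ₚ h) ≈ₚ (f *ₚ (g *ₚ h))
  *ₚ-assoc f g h zero = begin
    ((f *ₚ g) *ₚ h) 0        ≈⟨ +-identityˡ _ ⟩
    (f *ₚ g) 0 * h 0         ≈⟨ *-congʳ (+-identityˡ _) ⟩
    (f 0 * g 0) * h 0        ≈⟨ *-assoc _ _ _ ⟩
    f 0 * (g 0 * h 0)        ≈⟨ *-congˡ (sym (+-identityˡ _)) ⟩
    f 0 * (g *ₚ h) 0         ≈⟨ sym (+-identityˡ _) ⟩
    (f *ₚ (g *ₚ h)) 0        ∎
  *ₚ-assoc f g h (suc m) = begin
    ((f *ₚ g) *ₚ h) (suc m)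
      ≈⟨ *ₚ-suc (f *ₚ g) h m ⟩
    (f *ₚ g) 0 * h (suc m) + (((f *ₚ g) ∘ suc) *ₚ h) m
      ≈⟨ +-cong (*-congʳ (+-identityˡ _)) (*ₚ-cong {g = h} (*ₚ-suc f g) (λ _ → refl) m) ⟩
    (f 0 * g 0) * h (suc m) + ((λ k → f 0 * g (suc k) + ((f ∘ suc) *ₚ g) k) *ₚ h) m
      ≈⟨ +-congˡ (*ₚ-distribʳ _ _ h m) ⟩
    (f 0 * g 0) * h (suc m) + (((λ k → f 0 * g (suc k)) *ₚ h) m + (((f ∘ suc) *ₚ g) *ₚ h) m)
      ≈⟨ +-congˡ (+-cong (scale m) (*ₚ-assoc (f ∘ suc) g h m)) ⟩
    (f 0 * g 0) * h (suc m) + (f 0 * ((g ∘ suc) *ₚ h) m + ((f ∘ suc) *ₚ (g *ₚ h)) m)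
      ≈⟨ sym (+-assoc _ _ _) ⟩
    ((f 0 * g 0) * h (suc m) + f 0 * ((g ∘ suc) *ₚ h) m) + ((f ∘ suc) *ₚ (g *ₚ h)) m
      ≈⟨ +-congʳ (trans (+-congʳ (*-assoc _ _ _)) (sym (distribˡ _ _ _))) ⟩
    f 0 * (g 0 * h (suc m) + ((g ∘ suc) *ₚ h) m) + ((f ∘ suc) *ₚ (g *ₚ h)) m
      ≈⟨ +-congʳ (*-congˡ (sym (*ₚ-suc g h m))) ⟩
    f 0 * (g *ₚ h) (suc m) + ((f ∘ suc) *ₚ (g *ₚ h)) m
      ≈⟨ sym (*ₚ-suc f (g *ₚ h) m) ⟩
    (f *ₚ (g *ₚ h)) (suc m) ∎
    where
    scale : ∀ m → ((λ k → f 0 * g (suc k)) *ₚ h) m ≈ f 0 * ((g ∘ suc) *ₚ h) m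
    scale m = trans (∑-cong (suc m) (λ j _ → *-assoc _ _ _)) (sym (∑-distribˡ-* (suc m) (f 0) _))

  powerSeriesRing : CommutativeRing c ℓ
  powerSeriesRing = record
    { Carrier = PowerSeries ; _≈_ = _≈ₚ_
    ; _+_ = λ f g k → f k + g k ; _*_ = _*ₚ_ ; -_ = λ f k → - f k ; 0# = λ _ → 0# ; 1# = 1ₚ
    ; isCommutativeRing = record
      { isRing = record
        { +-isAbelianGroup = record
          { isGroup = record
            { isMonoid = record
              { isSemigroup = record
                { isMagma = record
                  { isEquivalence = record
                    { refl  = λ _ → refl
                    ; sym   = λ f≈g k → sym (f≈g k)
                    ; trans = λ f≈g g≈h k → trans (f≈g k) (g≈h k) }
                  ; ∙-cong = λ f≈ g≈ k → +-cong (f≈ k) (g≈ k) }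
                ; assoc = λ _ _ _ _ → +-assoc _ _ _ }
              ; identity = (λ _ _ → +-identityˡ _) , (λ _ _ → +-identityʳ _) }
            ; inverse = (λ _ _ → -‿inverseˡ _) , (λ _ _ → -‿inverseʳ _)
            ; ⁻¹-cong = λ f≈ k → -‿cong (f≈ k) }
          ; comm = λ _ _ _ → +-comm _ _ }
        ; *-cong = *ₚ-cong
        ; *-assoc = *ₚ-assoc
        ; *-identity = *ₚ-identityˡ , (λ f m → trans (*ₚ-comm f 1ₚ m) (*ₚ-identityˡ f m))
        ; distrib = (λ f g h m → trans (*ₚ-comm f _ m) (trans (*ₚ-distribʳ g h f m)
                                   (+-cong (*ₚ-comm g f m) (*ₚ-comm h f m))))
                  , (λ h f g → *ₚ-distribʳ f g h) }
      ; *-comm = *ₚ-comm } }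

module _ {c ℓ} (R : CommutativeRing c ℓ) where

  open CommutativeRing R

  -- Transports the ring laws to operations that agree with the ring's only propositionally.
  withOperations : (_+′_ _*′_ : Op₂ Carrier) (-′_ : Op₁ Carrier) (0′ 1′ : Carrier) →
                   (∀ x y → (x +′ y) ≈ (x + y)) → (∀ x y → (x *′ y) ≈ (x * y)) →
                   (∀ x → (-′ x) ≈ (- x)) → 0′ ≈ 0# → 1′ ≈ 1# → CommutativeRing c ℓ
  withOperations _+′_ _*′_ -′_ 0′ 1′ +≈ *≈ -≈ 0≈ 1≈ = record
    { Carrier = Carrier ; _≈_ = _≈_ ; _+_ = _+′_ ; _*_ = _*′_ ; -_ = -′_ ; 0# = 0′ ; 1# = 1′
    ; isCommutativeRing = record
      { isRing = record
        { +-isAbelianGroup = record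
          { isGroup = record
            { isMonoid = record
              { isSemigroup = record
                { isMagma = record { isEquivalence = isEquivalence ; ∙-cong = via₂ +≈ +-cong }
                ; assoc = λ x y z → trans (+≈ _ _) (trans (+-congʳ (+≈ _ _)) (trans (+-assoc x y z)
                            (sym (trans (+≈ _ _) (+-congˡ (+≈ _ _)))))) }
              ; identity = (λ x → trans (+≈ _ _) (trans (+-congʳ 0≈) (+-identityˡ x)))
                         , (λ x → trans (+≈ _ _) (trans (+-congˡ 0≈) (+-identityʳ x))) }
            ; inverse = (λ x → trans (+≈ _ _) (trans (+-congʳ (-≈ x)) (trans (-‿inverseˡ x) (sym 0≈))))
                      , (λ x → trans (+≈ _ _) (trans (+-congˡ (-≈ x)) (trans (-‿inverseʳ x) (sym 0≈))))
            ; ⁻¹-cong = λ x≈y → trans (-≈ _) (trans (-‿cong x≈y) (sym (-≈ _))) }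
          ; comm = λ x y → trans (+≈ _ _) (trans (+-comm x y) (sym (+≈ _ _))) }
        ; *-cong = via₂ *≈ *-cong
        ; *-assoc = λ x y z → trans (*≈ _ _) (trans (*-congʳ (*≈ _ _)) (trans (*-assoc x y z)
                      (sym (trans (*≈ _ _) (*-congˡ (*≈ _ _))))))
        ; *-identity = (λ x → trans (*≈ _ _) (trans (*-congʳ 1≈) (*-identityˡ x)))
                     , (λ x → trans (*≈ _ _) (trans (*-congˡ 1≈) (*-identityʳ x)))
        ; distrib = (λ x y z → trans (*≈ _ _) (trans (*-congˡ (+≈ _ _)) (trans (distribˡ x y z)
                       (sym (trans (+≈ _ _) (+-cong (*≈ _ _) (*≈ _ _)))))))
                  , (λ x y z → trans (*≈ _ _) (trans (*-congʳ (+≈ _ _)) (trans (distribʳ x y z)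
                       (sym (trans (+≈ _ _) (+-cong (*≈ _ _) (*≈ _ _))))))) }
      ; *-comm = λ x y → trans (*≈ _ _) (trans (*-comm x y) (sym (*≈ _ _))) } }
    where
    via₂ : ∀ {_∙′_ _∙_ : Op₂ Carrier} → (∀ x y → (x ∙′ y) ≈ (x ∙ y)) →
           (∀ {x x′ y y′} → x ≈ x′ → y ≈ y′ → (x ∙ y) ≈ (x′ ∙ y′)) →
           ∀ {x x′ y y′} → x ≈ x′ → y ≈ y′ → (x ∙′ y) ≈ (x′ ∙′ y′)
    via₂ ∙≈ ∙-cong x≈ y≈ = trans (∙≈ _ _) (trans (∙-cong x≈ y≈) (sym (∙≈ _ _)))

open import Level using (0ℓ)
import Algebra.Properties.Ring as RingProperties
open import Data.Bool using (true; false; if_then_else_; _∧_)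
open import Data.Bool.Properties using (∧-zeroʳ)
open import Data.Empty using (⊥; ⊥-elim)
open import Data.Fin using (Fin; toℕ; fromℕ<)
import Data.Fin.Properties as Fin
open import Data.Integer as ℤ using (ℤ; +_; -_; ∣_∣)
import Data.Integer.Properties as ℤ
open import Data.Integer.Properties using (+-*-commutativeRing)
open import Data.Integer.Tactic.RingSolver using (solve-∀)
open import Data.List using (List; []; _∷_; _++_; [_]; length; map)
open import Data.List.Properties using (length-++)
open import Data.List.Relation.Unary.All using (All; []; _∷_; all?)
import Data.Nat
open Data.Nat using (_≤_; _^_; _/_; _≡ᵇ_; _≤ᵇ_; _<ᵇ_; z≤n; s≤s)
open import Data.Nat.DivMod using (m*n/n≡m)
open import Data.Nat.Induction using (<-rec)
import Data.Nat.Tactic.RingSolver as ℕ-Solver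
open import Data.Product using (_×_; proj₁; proj₂)
open ≡ using (refl; sym; trans; cong; cong₂; subst; subst₂; module ≡-Reasoning)
open import Relation.Nullary using (yes; no)
open import Relation.Nullary.Decidable using (toWitness)
open import Relation.Nullary.Reflects using (Reflects; ofʸ; ofⁿ; fromEquivalence)
open import Defs

module ℤ[[X]] = FormalPowerSeries +-*-commutativeRing

sumℤ≡∑ : ∀ n f → sumℤ n f ≡ ℤ[[X]].∑ n f
sumℤ≡∑ zero    f = refl
sumℤ≡∑ (suc n) f = cong (ℤ._+ f n) (sumℤ≡∑ n f)

polyRing : CommutativeRing 0ℓ 0ℓ
polyRing = withOperations ℤ[[X]].powerSeriesRing _+P_ _*P_ -P_ 0P 1P
  (λ _ _ _ → refl) (λ _ _ k → sumℤ≡∑ (suc k) _) (λ _ _ → refl) (λ _ → refl)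
  (λ { zero → refl ; (suc _) → refl })

module Poly = CommutativeRing polyRing
module ℤ[[X]][[t]] = FormalPowerSeries polyRing

sumP≡∑ : ∀ n f k → sumP n f k ≡ ℤ[[X]][[t]].∑ n f k
sumP≡∑ zero    f k = refl
sumP≡∑ (suc n) f k = cong (ℤ._+ f n k) (sumP≡∑ n f k)

0S : Series
0S _ = 0P

seriesRing : CommutativeRing 0ℓ 0ℓ
seriesRing = withOperations ℤ[[X]][[t]].powerSeriesRing _+S_ _*S_ -S_ 0S 1S
  (λ _ _ _ _ → refl) (λ _ _ m k → sumP≡∑ (suc m) _ k) (λ _ _ _ → refl) (λ _ _ → refl)
  (λ { zero _ → refl ; (suc _) _ → refl })

module Series = CommutativeRing seriesRing

sumℤ-cong : ∀ n {f g : ℕ → ℤ} → (∀ j → j < n → f j ≡ g j) → sumℤ n f ≡ sumℤ n g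
sumℤ-cong n {f} {g} f≡g = trans (sumℤ≡∑ n f) (trans (ℤ[[X]].∑-cong n f≡g) (sym (sumℤ≡∑ n g)))

sumℤ-zero : ∀ n {f : ℕ → ℤ} → (∀ j → j < n → f j ≡ + 0) → sumℤ n f ≡ + 0
sumℤ-zero n {f} f≡0 = trans (sumℤ≡∑ n f) (ℤ[[X]].∑-zero n f≡0)

sumℤ-single : ∀ n a {f : ℕ → ℤ} → a < n → (∀ j → j < n → j ≢ a → f j ≡ + 0) →
              sumℤ n f ≡ f a
sumℤ-single n a {f} a<n f≡0 = trans (sumℤ≡∑ n f) (ℤ[[X]].∑-single n a f a<n f≡0)

sumℤ-head : ∀ n (f : ℕ → ℤ) → sumℤ (suc n) f ≡ f 0 ℤ.+ sumℤ n (λ j → f (suc j))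
sumℤ-head n f = trans (sumℤ≡∑ (suc n) f)
  (trans (ℤ[[X]].∑-head n f) (cong (λ s → f 0 ℤ.+ s) (sym (sumℤ≡∑ n _))))

sumℤ-split : ∀ a b (f : ℕ → ℤ) →
             sumℤ (a ℕ.+ b) f ≡ sumℤ a f ℤ.+ sumℤ b (λ i → f (a ℕ.+ i))
sumℤ-split a b f = trans (sumℤ≡∑ (a ℕ.+ b) f) (trans (ℤ[[X]].∑-split a b f)
  (sym (cong₂ ℤ._+_ (sumℤ≡∑ a f) (sumℤ≡∑ b _))))

sumℤ-comm : ∀ n m (f : ℕ → ℕ → ℤ) →
            sumℤ n (λ i → sumℤ m (f i)) ≡ sumℤ m (λ j → sumℤ n (λ i → f i j))
sumℤ-comm n m f = begin
  sumℤ n (λ i → sumℤ m (f i))             ≡⟨ sumℤ-cong n (λ i _ → sumℤ≡∑ m (f i)) ⟩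
  sumℤ n (λ i → ℤ[[X]].∑ m (f i))         ≡⟨ sumℤ≡∑ n _ ⟩
  ℤ[[X]].∑ n (λ i → ℤ[[X]].∑ m (f i))     ≡⟨ ℤ[[X]].∑-comm n m f ⟩
  ℤ[[X]].∑ m (λ j → ℤ[[X]].∑ n (λ i → f i j)) ≡⟨ sym (sumℤ≡∑ m _) ⟩
  sumℤ m (λ j → ℤ[[X]].∑ n (λ i → f i j)) ≡⟨ sumℤ-cong m (λ j _ → sym (sumℤ≡∑ n _)) ⟩
  sumℤ m (λ j → sumℤ n (λ i → f i j))     ∎
  where open ≡-Reasoning

-- Degree bounds and the variables u, v
DegreeBound : ℕ → Series → Set
DegreeBound a A = ∀ m k → a ℕ.+ m < k → A m k ≡ + 0

Bounded : Series → Set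
Bounded = DegreeBound 0

private
  remaining-degree : ∀ {a b j m l k} → l ≤ a ℕ.+ j → j ≤ m → l ≤ k →
                     (a ℕ.+ b) ℕ.+ m < k → b ℕ.+ (m ∸ j) < k ∸ l
  remaining-degree {a} {b} {j} {m} {l} {k} l≤a+j j≤m l≤k lt
    with ℕ.m≤n⇒∃[o]m+o≡n j≤m | ℕ.m≤n⇒∃[o]m+o≡n l≤k
  ... | s , refl | r , refl rewrite ℕ.m+n∸m≡n j s | ℕ.m+n∸m≡n l r =
    ℕ.+-cancelˡ-< l (b ℕ.+ s) r (ℕ.≤-<-trans (ℕ.+-monoˡ-≤ (b ℕ.+ s) l≤a+j)
      (subst (_< l ℕ.+ r) (regroup a b j s) lt))
    where
    regroup : ∀ a b j s → (a ℕ.+ b) ℕ.+ (j ℕ.+ s) ≡ (a ℕ.+ j) ℕ.+ (b ℕ.+ s)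
    regroup = ℕ-Solver.solve-∀

*S-degreeBound-upTo : ∀ {a b} (A B : Series) m →
  (∀ j k → j ≤ m → a ℕ.+ j < k → A j k ≡ + 0) →
  (∀ j k → j ≤ m → b ℕ.+ j < k → B j k ≡ + 0) →
  ∀ k → (a ℕ.+ b) ℕ.+ m < k → (A *S B) m k ≡ + 0
*S-degreeBound-upTo {a} {b} A B m A≡0 B≡0 k lt =
  sumℤ-zero (suc m) λ j j<1+m → sumℤ-zero (suc k) λ l l<1+k →
    term j l (ℕ.≤-pred j<1+m) (ℕ.≤-pred l<1+k)
  where
  term : ∀ j l → j ≤ m → l ≤ k → A j l ℤ.* B (m ∸ j) (k ∸ l) ≡ + 0
  term j l j≤m l≤k with a ℕ.+ j ℕ.<? l
  ... | yes a+j<l = cong (ℤ._* B (m ∸ j) (k ∸ l)) (A≡0 j l j≤m a+j<l)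
  ... | no  a+j≮l = trans
    (cong (A j l ℤ.*_) (B≡0 (m ∸ j) (k ∸ l) (ℕ.m∸n≤m m j)
      (remaining-degree (ℕ.≮⇒≥ a+j≮l) j≤m l≤k lt)))
    (ℤ.*-zeroʳ (A j l))

*S-degreeBound : ∀ {a b} (A B : Series) → DegreeBound a A → DegreeBound b B →
                 DegreeBound (a ℕ.+ b) (A *S B)
*S-degreeBound A B A≡0 B≡0 m = *S-degreeBound-upTo A B m (λ j k _ → A≡0 j k) (λ j k _ → B≡0 j k)

length-invList : ∀ A m → length (invList A m) ≡ suc m
length-invList A zero    = refl
length-invList A (suc m) = trans (length-++ (invList A m)) (trans (ℕ.+-comm _ 1) (cong suc (length-invList A m)))

lookup0-++ˡ : ∀ xs ys j → j < length xs → lookup0 (xs ++ ys) j ≡ lookup0 xs j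
lookup0-++ˡ (x ∷ xs) ys zero    _         = refl
lookup0-++ˡ (x ∷ xs) ys (suc j) (s≤s j<n) = lookup0-++ˡ xs ys j j<n

lookup0-++ʳ : ∀ xs ys i → lookup0 (xs ++ ys) (length xs ℕ.+ i) ≡ lookup0 ys i
lookup0-++ʳ []       ys i = refl
lookup0-++ʳ (x ∷ xs) ys i = lookup0-++ʳ xs ys i

lookup0-invList : ∀ A m j → j ≤ m → lookup0 (invList A m) j ≡ invS A j
lookup0-invList A m j j≤m with ℕ.m≤n⇒∃[o]m+o≡n j≤m
... | r , refl = prefix r
  where
  prefix : ∀ r → lookup0 (invList A (j ℕ.+ r)) j ≡ invS A j
  prefix zero    rewrite ℕ.+-identityʳ j = refl
  prefix (suc r) rewrite ℕ.+-suc j r = trans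
    (lookup0-++ˡ (invList A (j ℕ.+ r)) _ j
      (subst (j <_) (sym (length-invList A (j ℕ.+ r))) (s≤s (ℕ.m≤m+n j r))))
    (prefix r)

invS-suc : ∀ A m k → invS A (suc m) k ≡ - ((λ j → A (suc j)) *S invS A) m k
invS-suc A m k = begin
  lookup0 (invList A m ++ [ next ]) (suc m) k
    ≡⟨ cong (λ i → lookup0 (invList A m ++ [ next ]) i k)
            (sym (trans (ℕ.+-identityʳ _) (length-invList A m))) ⟩
  lookup0 (invList A m ++ [ next ]) (length (invList A m) ℕ.+ 0) k
    ≡⟨ cong (λ p → p k) (lookup0-++ʳ (invList A m) [ next ] 0) ⟩
  - sumℤ (suc m) (λ j → (A (suc j) *P lookup0 (invList A m) (m ∸ j)) k)
    ≡⟨ cong -_ (sumℤ-cong (suc m) λ j _ →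
         cong (λ p → (A (suc j) *P p) k) (lookup0-invList A m (m ∸ j) (ℕ.m∸n≤m m j))) ⟩
  - ((λ j → A (suc j)) *S invS A) m k ∎
  where
  open ≡-Reasoning
  next : Poly
  next = -P (sumP (suc m) (λ j → A (suc j) *P lookup0 (invList A m) (m ∸ j)))

invS-inverseʳ : ∀ A → A 0 Poly.≈ 1P → (A *S invS A) Series.≈ 1S
invS-inverseʳ A A₀≈1 zero k = begin
  + 0 ℤ.+ (A 0 *P 1P) k ≡⟨ ℤ.+-identityˡ _ ⟩
  (A 0 *P 1P) k         ≡⟨ Poly.*-congʳ {1P} {A 0} {1P} A₀≈1 k ⟩
  (1P *P 1P) k          ≡⟨ Poly.*-identityʳ 1P k ⟩
  1P k                  ∎
  where open ≡-Reasoning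
invS-inverseʳ A A₀≈1 (suc m) k = begin
  (A *S invS A) (suc m) k             ≡⟨ sumℤ-head (suc m) _ ⟩
  (A 0 *P invS A (suc m)) k ℤ.+ tail  ≡⟨ cong (ℤ._+ tail) (Poly.*-congʳ {invS A (suc m)} {A 0} {1P} A₀≈1 k) ⟩
  (1P *P invS A (suc m)) k ℤ.+ tail   ≡⟨ cong (ℤ._+ tail) (Poly.*-identityˡ (invS A (suc m)) k) ⟩
  invS A (suc m) k ℤ.+ tail           ≡⟨ cong (ℤ._+ tail) (invS-suc A m k) ⟩
  - tail ℤ.+ tail                     ≡⟨ ℤ.+-inverseˡ tail ⟩
  + 0                                 ∎
  where
  open ≡-Reasoning
  tail : ℤ
  tail = ((λ j → A (suc j)) *S invS A) m k

invS-bounded : ∀ A → Bounded A → A 0 Poly.≈ 1P → Bounded (invS A)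
invS-bounded A A-bounded A₀≈1 m = upTo m m ℕ.≤-refl
  where
  upTo : ∀ m j → j ≤ m → ∀ k → j < k → invS A j k ≡ + 0
  upTo zero    zero _ (suc k) _ = refl
  upTo (suc m) j j≤1+m k j<k with j ℕ.≟ suc m
  ... | no  j≢1+m = upTo m j (ℕ.≤-pred (ℕ.≤∧≢⇒< j≤1+m j≢1+m)) k j<k
  ... | yes refl  = trans (invS-suc A m k) (cong -_
    (*S-degreeBound-upTo {1} {0} (λ j → A (suc j)) (invS A) m
      (λ j k _ → A-bounded (suc j) k) (λ j k j≤m → upTo m j j≤m k)
      k j<k))

-- A in the variables u = t and v = tX, using t^m X^k = u^(m-k) v^k
toUV : Series → Series
toUV A d e = A (d ℕ.+ e) e

private
  -- Only l ≤ j ≤ l + d contributes: A j l vanishes for j < l, and B (N ∸ j) r for N ∸ j < r.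
  toUV-*-column : ∀ (A B : Series) → Bounded A → Bounded B → ∀ d l r →
    sumℤ (suc (d ℕ.+ (l ℕ.+ r))) (λ j → A j l ℤ.* B (d ℕ.+ (l ℕ.+ r) ∸ j) r)
    ≡ sumℤ (suc d) (λ i → toUV A i l ℤ.* toUV B (d ∸ i) r)
  toUV-*-column A B A-bounded B-bounded d l r = begin
    sumℤ (suc N) F
      ≡⟨ cong (λ n → sumℤ n F) (length-split d l r) ⟩
    sumℤ (l ℕ.+ (suc d ℕ.+ r)) F
      ≡⟨ sumℤ-split l (suc d ℕ.+ r) F ⟩
    sumℤ l F ℤ.+ middle
      ≡⟨ cong (ℤ._+ middle) (sumℤ-zero l below) ⟩
    + 0 ℤ.+ middle
      ≡⟨ ℤ.+-identityˡ middle ⟩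
    middle
      ≡⟨ sumℤ-split (suc d) r _ ⟩
    window ℤ.+ sumℤ r (λ i → F (l ℕ.+ (suc d ℕ.+ i)))
      ≡⟨ cong (λ s → window ℤ.+ s) (sumℤ-zero r above) ⟩
    window ℤ.+ + 0
      ≡⟨ ℤ.+-identityʳ window ⟩
    window
      ≡⟨ sumℤ-cong (suc d) (λ i i<1+d → inWindow i (ℕ.≤-pred i<1+d)) ⟩
    sumℤ (suc d) (λ i → toUV A i l ℤ.* toUV B (d ∸ i) r) ∎
    where
    open ≡-Reasoning
    N : ℕ
    N = d ℕ.+ (l ℕ.+ r)
    F : ℕ → ℤ
    F j = A j l ℤ.* B (N ∸ j) r
    middle window : ℤ
    middle = sumℤ (suc d ℕ.+ r) (λ i → F (l ℕ.+ i))
    window = sumℤ (suc d) (λ i → F (l ℕ.+ i))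

    length-split : ∀ d l r → suc (d ℕ.+ (l ℕ.+ r)) ≡ l ℕ.+ (suc d ℕ.+ r)
    length-split = ℕ-Solver.solve-∀
    N-regroup : ∀ d l r → d ℕ.+ (l ℕ.+ r) ≡ l ℕ.+ (d ℕ.+ r)
    N-regroup = ℕ-Solver.solve-∀

    below : ∀ j → j < l → F j ≡ + 0
    below j j<l = cong (ℤ._* B (N ∸ j) r) (A-bounded j l j<l)

    above : ∀ i → i < r → F (l ℕ.+ (suc d ℕ.+ i)) ≡ + 0
    above i i<r = trans (cong (A _ l ℤ.*_) (B-bounded _ r (subst (_< r) (sym N∸j≡r∸1+i) r∸1+i<r)))
                        (ℤ.*-zeroʳ (A (l ℕ.+ (suc d ℕ.+ i)) l))
      where
      regroup : ∀ d l i → l ℕ.+ (suc d ℕ.+ i) ≡ l ℕ.+ (d ℕ.+ suc i)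
      regroup = ℕ-Solver.solve-∀
      N∸j≡r∸1+i : N ∸ (l ℕ.+ (suc d ℕ.+ i)) ≡ r ∸ suc i
      N∸j≡r∸1+i rewrite N-regroup d l r | regroup d l i
        | ℕ.[m+n]∸[m+o]≡n∸o l (d ℕ.+ r) (d ℕ.+ suc i) = ℕ.[m+n]∸[m+o]≡n∸o d r (suc i)
      r∸1+i<r : r ∸ suc i < r
      r∸1+i<r = ℕ.∸-monoʳ-< {o = 0} (s≤s z≤n) i<r

    inWindow : ∀ i → i ≤ d → F (l ℕ.+ i) ≡ toUV A i l ℤ.* toUV B (d ∸ i) r
    inWindow i i≤d = cong₂ (λ x y → A x l ℤ.* B y r) (ℕ.+-comm l i) N∸j≡d∸i+r
      where
      N∸j≡d∸i+r : N ∸ (l ℕ.+ i) ≡ (d ∸ i) ℕ.+ r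
      N∸j≡d∸i+r rewrite N-regroup d l r | ℕ.[m+n]∸[m+o]≡n∸o l (d ℕ.+ r) i = ℕ.+-∸-comm r i≤d

toUV-* : ∀ (A B : Series) → Bounded A → Bounded B → toUV (A *S B) Series.≈ (toUV A *S toUV B)
toUV-* A B A-bounded B-bounded d e = begin
  sumℤ (suc (d ℕ.+ e)) (λ j → sumℤ (suc e) (λ l → A j l ℤ.* B (d ℕ.+ e ∸ j) (e ∸ l)))
    ≡⟨ sumℤ-comm (suc (d ℕ.+ e)) (suc e) _ ⟩
  sumℤ (suc e) (λ l → sumℤ (suc (d ℕ.+ e)) (λ j → A j l ℤ.* B (d ℕ.+ e ∸ j) (e ∸ l)))
    ≡⟨ sumℤ-cong (suc e) (λ l l<1+e → column l (ℕ.≤-pred l<1+e)) ⟩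
  sumℤ (suc e) (λ l → sumℤ (suc d) (λ i → toUV A i l ℤ.* toUV B (d ∸ i) (e ∸ l)))
    ≡⟨ sumℤ-comm (suc e) (suc d) _ ⟩
  (toUV A *S toUV B) d e ∎
  where
  open ≡-Reasoning
  column : ∀ l → l ≤ e →
    sumℤ (suc (d ℕ.+ e)) (λ j → A j l ℤ.* B (d ℕ.+ e ∸ j) (e ∸ l))
    ≡ sumℤ (suc d) (λ i → toUV A i l ℤ.* toUV B (d ∸ i) (e ∸ l))
  column l l≤e with ℕ.m≤n⇒∃[o]m+o≡n l≤e
  ... | r , refl rewrite ℕ.m+n∸m≡n l r = toUV-*-column A B A-bounded B-bounded d l r

open RingProperties Series.ring using (-‿distribˡ-*)

-- Congruence modulo u^N
infix 4 _≈[_]_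

_≈[_]_ : Series → ℕ → Series → Set
A ≈[ N ] B = ∀ d e → d < N → A d e ≡ B d e

≈⇒≈[] : ∀ {A B N} → A Series.≈ B → A ≈[ N ] B
≈⇒≈[] A≈B d e _ = A≈B d e

≈[]-sym : ∀ {A B N} → A ≈[ N ] B → B ≈[ N ] A
≈[]-sym A≈B d e d<N = sym (A≈B d e d<N)

≈[]-trans : ∀ {A B C N} → A ≈[ N ] B → B ≈[ N ] C → A ≈[ N ] C
≈[]-trans A≈B B≈C d e d<N = trans (A≈B d e d<N) (B≈C d e d<N)

*S-cong-≈[] : ∀ {A A′ B B′ N} → A ≈[ N ] A′ → B ≈[ N ] B′ → (A *S B) ≈[ N ] (A′ *S B′)
*S-cong-≈[] A≈ B≈ d e d<N =
  sumℤ-cong (suc d) λ j j<1+d → sumℤ-cong (suc e) λ l _ →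
    cong₂ ℤ._*_ (A≈ j l (ℕ.≤-<-trans (ℕ.≤-pred j<1+d) d<N))
                (B≈ (d ∸ j) (e ∸ l) (ℕ.≤-<-trans (ℕ.m∸n≤m d j) d<N))

-- Once F vanishes at every index lexicographically below (d, e), the coefficient of
-- u^d v^e in F * D is F d e * D 0 0.
*S-annihilatorʳ : ∀ {N} (F D : Series) → D 0 0 ≡ + 1 → (F *S D) ≈[ N ] 0S → F ≈[ N ] 0S
*S-annihilatorʳ {N} F D D₀₀≡1 FD≈0 d e d<N = <-rec (λ d → d < N → ∀ e → F d e ≡ + 0) row d d<N e
  where
  row : ∀ d → (∀ {d′} → d′ < d → d′ < N → ∀ e → F d′ e ≡ + 0) →
        d < N → ∀ e → F d e ≡ + 0
  row d earlierRows d<N = <-rec (λ e → F d e ≡ + 0) entry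
    where
    entry : ∀ e → (∀ {e′} → e′ < e → F d e′ ≡ + 0) → F d e ≡ + 0
    entry e earlierEntries = begin
      F d e                                  ≡⟨ sym (ℤ.*-identityʳ (F d e)) ⟩
      F d e ℤ.* + 1                          ≡⟨ cong (F d e ℤ.*_) (sym D₀₀≡1) ⟩
      F d e ℤ.* D 0 0                        ≡⟨ cong₂ (λ i j → F d e ℤ.* D i j)
                                                      (sym (ℕ.n∸n≡0 d)) (sym (ℕ.n∸n≡0 e)) ⟩
      F d e ℤ.* D (d ∸ d) (e ∸ e)            ≡⟨ sym (sumℤ-single (suc e) e ℕ.≤-refl lastColumn) ⟩
      sumℤ (suc e) (λ l → F d l ℤ.* D (d ∸ d) (e ∸ l))
                                             ≡⟨ sym (sumℤ-single (suc d) d ℕ.≤-refl lastRow) ⟩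
      (F *S D) d e                           ≡⟨ FD≈0 d e d<N ⟩
      + 0                                    ∎
      where
      open ≡-Reasoning
      lastColumn : ∀ l → l < suc e → l ≢ e → F d l ℤ.* D (d ∸ d) (e ∸ l) ≡ + 0
      lastColumn l l<1+e l≢e =
        cong (ℤ._* D (d ∸ d) (e ∸ l)) (earlierEntries (ℕ.≤∧≢⇒< (ℕ.≤-pred l<1+e) l≢e))
      lastRow : ∀ j → j < suc d → j ≢ d →
                sumℤ (suc e) (λ l → F j l ℤ.* D (d ∸ j) (e ∸ l)) ≡ + 0
      lastRow j j<1+d j≢d = sumℤ-zero (suc e) λ l _ →
        cong (ℤ._* D (d ∸ j) (e ∸ l)) (earlierRows j<d (ℕ.<-trans j<d d<N) l)
        where
        j<d : j < d
        j<d = ℕ.≤∧≢⇒< (ℕ.≤-pred j<1+d) j≢d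

*S-cancelʳ-≈[] : ∀ {N} (G H D : Series) → D 0 0 ≡ + 1 → (G *S D) ≈[ N ] (H *S D) → G ≈[ N ] H
*S-cancelʳ-≈[] G H D D₀₀≡1 GD≈HD d e d<N = ℤ.i-j≡0⇒i≡j (G d e) (H d e)
  (*S-annihilatorʳ (G -S H) D D₀₀≡1 difference d e d<N)
  where
  difference : ((G -S H) *S D) ≈[ _ ] 0S
  difference d e d<N = begin
    ((G -S H) *S D) d e
      ≡⟨ Series.distribʳ D G (-S H) d e ⟩
    (G *S D) d e ℤ.+ ((-S H) *S D) d e
      ≡⟨ cong (λ s → (G *S D) d e ℤ.+ s) (sym (-‿distribˡ-* H D d e)) ⟩
    (G *S D) d e ℤ.- (H *S D) d e
      ≡⟨ cong (ℤ._- (H *S D) d e) (GD≈HD d e d<N) ⟩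
    (H *S D) d e ℤ.- (H *S D) d e
      ≡⟨ ℤ.+-inverseʳ ((H *S D) d e) ⟩
    + 0 ∎
    where open ≡-Reasoning

≈[]-weaken : ∀ {A B M N} → M ≤ N → A ≈[ N ] B → A ≈[ M ] B
≈[]-weaken M≤N A≈B d e d<M = A≈B d e (ℕ.<-≤-trans d<M M≤N)

-- Series with finitely many terms
-- (a , b , c) stands for the monomial c t^a X^b
Monomial : Set
Monomial = ℕ × ℕ × ℤ

≡ᵇ-reflects : ∀ m n → Reflects (m ≡ n) (m ≡ᵇ n)
≡ᵇ-reflects m n = fromEquivalence (ℕ.≡ᵇ⇒≡ m n) (ℕ.≡⇒≡ᵇ m n)

≤ᵇ-reflects : ∀ m n → Reflects (m ≤ n) (m ≤ᵇ n)
≤ᵇ-reflects m n = fromEquivalence (ℕ.≤ᵇ⇒≤ m n) ℕ.≤⇒≤ᵇ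

δ : ℕ → ℕ → Series
δ a b m k = if (m ≡ᵇ a) ∧ (k ≡ᵇ b) then + 1 else + 0

δ-diag : ∀ a b → δ a b a b ≡ + 1
δ-diag a b with a ≡ᵇ a | ≡ᵇ-reflects a a | b ≡ᵇ b | ≡ᵇ-reflects b b
... | true  | _        | true  | _        = refl
... | true  | _        | false | ofⁿ b≢b = ⊥-elim (b≢b refl)
... | false | ofⁿ a≢a  | _     | _        = ⊥-elim (a≢a refl)

δ-off : ∀ a b m k → (m ≡ a → k ≡ b → ⊥) → δ a b m k ≡ + 0
δ-off a b m k off with m ≡ᵇ a | ≡ᵇ-reflects m a | k ≡ᵇ b | ≡ᵇ-reflects k b
... | true  | ofʸ m≡a | true  | ofʸ k≡b = ⊥-elim (off m≡a k≡b)
... | true  | _       | false | _       = refl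
... | false | _       | _     | _       = refl

monomial : Monomial → Series
monomial (a , b , c) m k = δ a b m k ℤ.* c

⟦_⟧ : List Monomial → Series
⟦ []    ⟧ m k = + 0
⟦ x ∷ p ⟧ m k = monomial x m k ℤ.+ ⟦ p ⟧ m k

⟦++⟧ : ∀ p q → ⟦ p ++ q ⟧ Series.≈ (⟦ p ⟧ +S ⟦ q ⟧)
⟦++⟧ []      q m k = sym (ℤ.+-identityˡ _)
⟦++⟧ (x ∷ p) q m k = trans (cong (λ s → monomial x m k ℤ.+ s) (⟦++⟧ p q m k))
                            (sym (ℤ.+-assoc (monomial x m k) (⟦ p ⟧ m k) (⟦ q ⟧ m k)))

negate : List Monomial → List Monomial
negate = map (λ { (a , b , c) → (a , b , - c) })

⟦negate⟧ : ∀ p → ⟦ negate p ⟧ Series.≈ (-S ⟦ p ⟧)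
⟦negate⟧ []              m k = refl
⟦negate⟧ ((a , b , c) ∷ p) m k = sym (trans (ℤ.neg-distrib-+ (δ a b m k ℤ.* c) (⟦ p ⟧ m k))
  (cong₂ ℤ._+_ (ℤ.neg-distribʳ-* (δ a b m k) c) (sym (⟦negate⟧ p m k))))

shiftBy : Monomial → Series → Series
shiftBy (a , b , c) A m k = if (a ≤ᵇ m) ∧ (b ≤ᵇ k) then c ℤ.* A (m ∸ a) (k ∸ b) else + 0

monomial-*S : ∀ x A → (monomial x *S A) Series.≈ shiftBy x A
monomial-*S (a , b , c) A m k with a ≤ᵇ m | ≤ᵇ-reflects a m | b ≤ᵇ k | ≤ᵇ-reflects b k
... | true | ofʸ a≤m | true | ofʸ b≤k = begin
  sumℤ (suc m) (λ j → sumℤ (suc k) (λ l → δ a b j l ℤ.* c ℤ.* A (m ∸ j) (k ∸ l)))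
    ≡⟨ sumℤ-single (suc m) a (s≤s a≤m) (λ j _ j≢a →
         sumℤ-zero (suc k) λ l _ → vanish j l (λ j≡a _ → j≢a j≡a)) ⟩
  sumℤ (suc k) (λ l → δ a b a l ℤ.* c ℤ.* A (m ∸ a) (k ∸ l))
    ≡⟨ sumℤ-single (suc k) b (s≤s b≤k) (λ l _ l≢b → vanish a l (λ _ l≡b → l≢b l≡b)) ⟩
  δ a b a b ℤ.* c ℤ.* A (m ∸ a) (k ∸ b)
    ≡⟨ cong (λ i → i ℤ.* c ℤ.* A (m ∸ a) (k ∸ b)) (δ-diag a b) ⟩
  + 1 ℤ.* c ℤ.* A (m ∸ a) (k ∸ b)
    ≡⟨ cong (ℤ._* A (m ∸ a) (k ∸ b)) (ℤ.*-identityˡ c) ⟩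
  c ℤ.* A (m ∸ a) (k ∸ b) ∎
  where
  open ≡-Reasoning
  vanish : ∀ j l → (j ≡ a → l ≡ b → ⊥) → δ a b j l ℤ.* c ℤ.* A (m ∸ j) (k ∸ l) ≡ + 0
  vanish j l off = cong (λ i → i ℤ.* c ℤ.* A (m ∸ j) (k ∸ l)) (δ-off a b j l off)
... | true | _ | false | ofⁿ b≰k = sumℤ-zero (suc m) λ j _ → sumℤ-zero (suc k) λ l l<1+k →
  cong (λ i → i ℤ.* c ℤ.* A (m ∸ j) (k ∸ l))
       (δ-off a b j l (λ _ l≡b → b≰k (subst (_≤ k) l≡b (ℕ.≤-pred l<1+k))))
... | false | ofⁿ a≰m | _ | _ = sumℤ-zero (suc m) λ j j<1+m → sumℤ-zero (suc k) λ l _ →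
  cong (λ i → i ℤ.* c ℤ.* A (m ∸ j) (k ∸ l))
       (δ-off a b j l (λ j≡a _ → a≰m (subst (_≤ m) j≡a (ℕ.≤-pred j<1+m))))

multiply : List Monomial → Series → Series
multiply []      A m k = + 0
multiply (x ∷ p) A m k = shiftBy x A m k ℤ.+ multiply p A m k

⟦⟧-*S : ∀ p A → (⟦ p ⟧ *S A) Series.≈ multiply p A
⟦⟧-*S []      A m k = Series.zeroˡ A m k
⟦⟧-*S (x ∷ p) A m k = trans (Series.distribʳ A (monomial x) ⟦ p ⟧ m k)
                              (cong₂ ℤ._+_ (monomial-*S x A m k) (⟦⟧-*S p A m k))

times : Monomial → Monomial → Monomial
times (a , b , c) (a′ , b′ , c′) = (a ℕ.+ a′ , b ℕ.+ b′ , c ℤ.* c′)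

private
  ≡ᵇ-+ : ∀ a r a′ → (a ℕ.+ r ≡ᵇ a ℕ.+ a′) ≡ (r ≡ᵇ a′)
  ≡ᵇ-+ zero    r a′ = refl
  ≡ᵇ-+ (suc a) r a′ = ≡ᵇ-+ a r a′

δ-shift : ∀ a b a′ b′ m k → a ≤ m → b ≤ k →
          δ a′ b′ (m ∸ a) (k ∸ b) ≡ δ (a ℕ.+ a′) (b ℕ.+ b′) m k
δ-shift a b a′ b′ m k a≤m b≤k with ℕ.m≤n⇒∃[o]m+o≡n a≤m | ℕ.m≤n⇒∃[o]m+o≡n b≤k
... | r , refl | s , refl rewrite ℕ.m+n∸m≡n a r | ℕ.m+n∸m≡n b s =
  cong₂ (λ x y → if x ∧ y then + 1 else + 0) (sym (≡ᵇ-+ a r a′)) (sym (≡ᵇ-+ b s b′))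

monomial-*S-monomial : ∀ x y → (monomial x *S monomial y) Series.≈ monomial (times x y)
monomial-*S-monomial (a , b , c) (a′ , b′ , c′) m k =
  trans (monomial-*S (a , b , c) (monomial (a′ , b′ , c′)) m k) lemma
  where
  lemma : shiftBy (a , b , c) (monomial (a′ , b′ , c′)) m k
          ≡ δ (a ℕ.+ a′) (b ℕ.+ b′) m k ℤ.* (c ℤ.* c′)
  lemma with a ≤ᵇ m | ≤ᵇ-reflects a m | b ≤ᵇ k | ≤ᵇ-reflects b k
  ... | true | ofʸ a≤m | true | ofʸ b≤k =
    trans (cong (c ℤ.*_) (cong (ℤ._* c′) (δ-shift a b a′ b′ m k a≤m b≤k)))
          (rotate c (δ (a ℕ.+ a′) (b ℕ.+ b′) m k) c′)
    where
    rotate : ∀ x y z → x ℤ.* (y ℤ.* z) ≡ y ℤ.* (x ℤ.* z)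
    rotate = solve-∀
  ... | true | _ | false | ofⁿ b≰k = sym (cong (ℤ._* (c ℤ.* c′))
    (δ-off _ _ m k (λ _ k≡b+b′ → b≰k (subst (b ≤_) (sym k≡b+b′) (ℕ.m≤m+n b b′)))))
  ... | false | ofⁿ a≰m | _ | _ = sym (cong (ℤ._* (c ℤ.* c′))
    (δ-off _ _ m k (λ m≡a+a′ _ → a≰m (subst (a ≤_) (sym m≡a+a′) (ℕ.m≤m+n a a′)))))

monomial-*S-⟦⟧ : ∀ x q → (monomial x *S ⟦ q ⟧) Series.≈ ⟦ map (times x) q ⟧
monomial-*S-⟦⟧ x []      m k = Series.zeroʳ (monomial x) m k
monomial-*S-⟦⟧ x (y ∷ q) m k = trans (Series.distribˡ (monomial x) (monomial y) ⟦ q ⟧ m k)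
  (cong₂ ℤ._+_ (monomial-*S-monomial x y m k) (monomial-*S-⟦⟧ x q m k))

mul : List Monomial → List Monomial → List Monomial
mul []      q = []
mul (x ∷ p) q = map (times x) q ++ mul p q

⟦mul⟧ : ∀ p q → ⟦ mul p q ⟧ Series.≈ (⟦ p ⟧ *S ⟦ q ⟧)
⟦mul⟧ []      q m k = sym (Series.zeroˡ ⟦ q ⟧ m k)
⟦mul⟧ (x ∷ p) q m k = begin
  ⟦ map (times x) q ++ mul p q ⟧ m k
    ≡⟨ ⟦++⟧ (map (times x) q) (mul p q) m k ⟩
  ⟦ map (times x) q ⟧ m k ℤ.+ ⟦ mul p q ⟧ m k
    ≡⟨ cong₂ ℤ._+_ (sym (monomial-*S-⟦⟧ x q m k)) (⟦mul⟧ p q m k) ⟩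
  (monomial x *S ⟦ q ⟧) m k ℤ.+ (⟦ p ⟧ *S ⟦ q ⟧) m k
    ≡⟨ sym (Series.distribʳ ⟦ q ⟧ (monomial x) ⟦ p ⟧ m k) ⟩
  (⟦ x ∷ p ⟧ *S ⟦ q ⟧) m k ∎
  where open ≡-Reasoning

Balanced : Monomial → Set
Balanced (a , b , _) = b ≤ a

⟦⟧-bounded : ∀ p → All Balanced p → Bounded ⟦ p ⟧
⟦⟧-bounded []                _             m k m<k = refl
⟦⟧-bounded ((a , b , c) ∷ p) (b≤a ∷ bal) m k m<k = cong₂ ℤ._+_
  (cong (ℤ._* c) (δ-off a b m k λ { refl refl → ℕ.<-irrefl refl (ℕ.<-≤-trans m<k b≤a) }))
  (⟦⟧-bounded p bal m k m<k)

uvMonomial : Monomial → Monomial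
uvMonomial (a , b , c) = (a ∸ b , b , c)

toUV-δ : ∀ a b d e → b ≤ a → δ a b (d ℕ.+ e) e ≡ δ (a ∸ b) b d e
toUV-δ a b d e b≤a with ℕ.m≤n⇒∃[o]m+o≡n b≤a
... | r , refl rewrite ℕ.m+n∸m≡n b r with e ≡ᵇ b | ≡ᵇ-reflects e b
...   | true  | ofʸ refl rewrite ℕ.+-comm d b = cong (λ x → if x ∧ true then + 1 else + 0) (≡ᵇ-+ b d r)
...   | false | _        = cong (if_then + 1 else + 0) (trans (∧-zeroʳ _) (sym (∧-zeroʳ _)))

toUV-⟦⟧ : ∀ p → All Balanced p → toUV ⟦ p ⟧ Series.≈ ⟦ map uvMonomial p ⟧
toUV-⟦⟧ []                _           d e = refl
toUV-⟦⟧ ((a , b , c) ∷ p) (b≤a ∷ bal) d e =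
  cong₂ ℤ._+_ (cong (ℤ._* c) (toUV-δ a b d e b≤a)) (toUV-⟦⟧ p bal d e)

truncate : ℕ → List Monomial → List Monomial
truncate N []                = []
truncate N ((a , b , c) ∷ p) = if a <ᵇ N then (a , b , c) ∷ truncate N p else truncate N p

truncate-≈[] : ∀ N p → ⟦ p ⟧ ≈[ N ] ⟦ truncate N p ⟧
truncate-≈[] N []                d e d<N = refl
truncate-≈[] N ((a , b , c) ∷ p) d e d<N with a <ᵇ N | ℕ.<ᵇ-reflects-< a N
... | true  | _        = cong (λ s → monomial (a , b , c) d e ℤ.+ s) (truncate-≈[] N p d e d<N)
... | false | ofⁿ a≮N = trans
  (cong₂ ℤ._+_ (cong (ℤ._* c) (δ-off a b d e (λ { refl _ → a≮N d<N }))) (truncate-≈[] N p d e d<N))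
  (ℤ.+-identityˡ _)

open CommutativeSemigroupProperties Series.*-commutativeSemigroup using (interchange)

-- The factors of the product
oneᴸ : List Monomial
oneᴸ = (0 , 0 , + 1) ∷ []

tPowᴸ : ℕ → List Monomial
tPowᴸ i = (i , 0 , + 1) ∷ []

Xᴸ : List Monomial
Xᴸ = (0 , 1 , + 1) ∷ []

⟦oneᴸ⟧ : ⟦ oneᴸ ⟧ Series.≈ 1S
⟦oneᴸ⟧ zero    zero    = refl
⟦oneᴸ⟧ zero    (suc k) = refl
⟦oneᴸ⟧ (suc m) k       = refl

⟦tPowᴸ⟧ : ∀ i → ⟦ tPowᴸ i ⟧ Series.≈ tPow i
⟦tPowᴸ⟧ i m k with m ℕ.≟ i
⟦tPowᴸ⟧ i m zero    | yes refl = cong (λ s → s ℤ.* + 1 ℤ.+ + 0) (δ-diag i 0)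
⟦tPowᴸ⟧ i m (suc k) | yes refl = cong (λ s → s ℤ.* + 1 ℤ.+ + 0) (δ-off i 0 m (suc k) (λ _ ()))
⟦tPowᴸ⟧ i m k       | no m≢i   = cong (λ s → s ℤ.* + 1 ℤ.+ + 0) (δ-off i 0 m k λ m≡i _ → m≢i m≡i)

⟦Xᴸ⟧ : ⟦ Xᴸ ⟧ Series.≈ constS XP
⟦Xᴸ⟧ zero    zero          = refl
⟦Xᴸ⟧ zero    (suc zero)    = refl
⟦Xᴸ⟧ zero    (suc (suc k)) = refl
⟦Xᴸ⟧ (suc m) k             = refl

denomᴸ : ℕ → List Monomial
denomᴸ i = (oneᴸ ++ negate (mul Xᴸ (tPowᴸ i))) ++ tPowᴸ (i ℕ.+ i)

⟦denomᴸ⟧ : ∀ i → ⟦ denomᴸ i ⟧ Series.≈ denom i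
⟦denomᴸ⟧ i m k = begin
  ⟦ (oneᴸ ++ negate Xtᴸ) ++ tPowᴸ (i ℕ.+ i) ⟧ m k
    ≡⟨ ⟦++⟧ (oneᴸ ++ negate Xtᴸ) (tPowᴸ (i ℕ.+ i)) m k ⟩
  ⟦ oneᴸ ++ negate Xtᴸ ⟧ m k ℤ.+ ⟦ tPowᴸ (i ℕ.+ i) ⟧ m k
    ≡⟨ cong₂ ℤ._+_ (⟦++⟧ oneᴸ (negate Xtᴸ) m k) (⟦tPowᴸ⟧ (i ℕ.+ i) m k) ⟩
  (⟦ oneᴸ ⟧ m k ℤ.+ ⟦ negate Xtᴸ ⟧ m k) ℤ.+ tPow (i ℕ.+ i) m k
    ≡⟨ cong (ℤ._+ tPow (i ℕ.+ i) m k)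
            (cong₂ ℤ._+_ (⟦oneᴸ⟧ m k) (trans (⟦negate⟧ Xtᴸ m k) (cong -_ Xt≈))) ⟩
  denom i m k ∎
  where
  open ≡-Reasoning
  Xtᴸ : List Monomial
  Xtᴸ = mul Xᴸ (tPowᴸ i)
  Xt≈ : ⟦ Xtᴸ ⟧ m k ≡ (constS XP *S tPow i) m k
  Xt≈ = trans (⟦mul⟧ Xᴸ (tPowᴸ i) m k)
              (Series.*-cong {⟦ Xᴸ ⟧} {constS XP} {⟦ tPowᴸ i ⟧} {tPow i} ⟦Xᴸ⟧ (⟦tPowᴸ⟧ i) m k)

numerator : ℕ → Series
numerator i = (1S -S tPow i) *S (1S -S tPow i)

oneMinusᴸ : ℕ → List Monomial
oneMinusᴸ i = oneᴸ ++ negate (tPowᴸ i)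

numeratorᴸ : ℕ → List Monomial
numeratorᴸ i = mul (oneMinusᴸ i) (oneMinusᴸ i)

⟦numeratorᴸ⟧ : ∀ i → ⟦ numeratorᴸ i ⟧ Series.≈ numerator i
⟦numeratorᴸ⟧ i m k = trans (⟦mul⟧ (oneMinusᴸ i) (oneMinusᴸ i) m k)
  (Series.*-cong {⟦ oneMinusᴸ i ⟧} {1S -S tPow i} {⟦ oneMinusᴸ i ⟧} {1S -S tPow i}
            oneMinus≈ oneMinus≈ m k)
  where
  oneMinus≈ : ⟦ oneMinusᴸ i ⟧ Series.≈ (1S -S tPow i)
  oneMinus≈ m k = trans (⟦++⟧ oneᴸ (negate (tPowᴸ i)) m k)
    (cong₂ ℤ._+_ (⟦oneᴸ⟧ m k) (trans (⟦negate⟧ (tPowᴸ i) m k) (cong -_ (⟦tPowᴸ⟧ i m k))))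

bounded-resp : ∀ {A B} → A Series.≈ B → Bounded A → Bounded B
bounded-resp A≈B A-bounded m k m<k = trans (sym (A≈B m k)) (A-bounded m k m<k)

denomᴸ-balanced : ∀ j → All Balanced (denomᴸ (suc j))
denomᴸ-balanced j = z≤n ∷ s≤s z≤n ∷ z≤n ∷ []

numeratorᴸ-balanced : ∀ i → All Balanced (numeratorᴸ i)
numeratorᴸ-balanced i = z≤n ∷ z≤n ∷ z≤n ∷ z≤n ∷ []

denom-bounded : ∀ j → Bounded (denom (suc j))
denom-bounded j = bounded-resp (⟦denomᴸ⟧ (suc j)) (⟦⟧-bounded (denomᴸ (suc j)) (denomᴸ-balanced j))

numerator-bounded : ∀ i → Bounded (numerator i)
numerator-bounded i = bounded-resp (⟦numeratorᴸ⟧ i) (⟦⟧-bounded (numeratorᴸ i) (numeratorᴸ-balanced i))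

denom-constant : ∀ j → denom (suc j) 0 Poly.≈ 1P
denom-constant j k = trans (sym (⟦denomᴸ⟧ (suc j) 0 k)) (constant k)
  where
  constant : ∀ k → ⟦ denomᴸ (suc j) ⟧ 0 k ≡ 1P k
  constant zero    = refl
  constant (suc k) = refl

factor-bounded : ∀ j → Bounded (factor (suc j))
factor-bounded j = *S-degreeBound (numerator (suc j)) (invS (denom (suc j))) (numerator-bounded (suc j))
  (invS-bounded (denom (suc j)) (denom-bounded j) (denom-constant j))

prodTo-bounded : ∀ n → Bounded (prodTo n)
prodTo-bounded zero    = bounded-resp ⟦oneᴸ⟧ (⟦⟧-bounded oneᴸ (z≤n ∷ []))
prodTo-bounded (suc n) = *S-degreeBound (prodTo n) (factor (suc n)) (prodTo-bounded n) (factor-bounded n)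

factor-*S-denom : ∀ j → (factor (suc j) *S denom (suc j)) Series.≈ numerator (suc j)
factor-*S-denom j = begin
  (numerator i *S invS (denom i)) *S denom i
    ≈⟨ Series.*-assoc (numerator i) (invS (denom i)) (denom i) ⟩
  numerator i *S (invS (denom i) *S denom i)
    ≈⟨ Series.*-congˡ {numerator i} (Series.*-comm (invS (denom i)) (denom i)) ⟩
  numerator i *S (denom i *S invS (denom i))
    ≈⟨ Series.*-congˡ {numerator i} (invS-inverseʳ (denom i) (denom-constant j)) ⟩
  numerator i *S 1S
    ≈⟨ Series.*-identityʳ (numerator i) ⟩
  numerator i ∎
  where
  open SetoidReasoning Series.setoid
  i : ℕ
  i = suc j

toUV-cong : ∀ {A B} → A Series.≈ B → toUV A Series.≈ toUV B
toUV-cong A≈B d e = A≈B (d ℕ.+ e) e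

toUV-1S : toUV 1S Series.≈ 1S
toUV-1S zero    zero    = refl
toUV-1S zero    (suc e) = refl
toUV-1S (suc d) zero    = refl
toUV-1S (suc d) (suc e) = refl

⟦⟧-≈[]-leading : ∀ {N} x p → All (λ y → N ≤ proj₁ y) p → ⟦ x ∷ p ⟧ ≈[ N ] ⟦ x ∷ [] ⟧
⟦⟧-≈[]-leading x p high d e d<N = cong (λ s → monomial x d e ℤ.+ s) (vanish p high)
  where
  vanish : ∀ p → All (λ y → _ ≤ proj₁ y) p → ⟦ p ⟧ d e ≡ + 0
  vanish []                _             = refl
  vanish ((a , b , c) ∷ p) (N≤a ∷ high) = cong₂ ℤ._+_
    (cong (ℤ._* c) (δ-off a b d e (λ { refl _ → ℕ.<-irrefl refl (ℕ.<-≤-trans d<N N≤a) })))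
    (vanish p high)

toUV-denom : ∀ j → toUV (denom (suc j)) Series.≈ ⟦ map uvMonomial (denomᴸ (suc j)) ⟧
toUV-denom j = Series.trans (toUV-cong (Series.sym (⟦denomᴸ⟧ (suc j))))
                       (toUV-⟦⟧ (denomᴸ (suc j)) (denomᴸ-balanced j))

toUV-numerator : ∀ i → toUV (numerator i) Series.≈ ⟦ map uvMonomial (numeratorᴸ i) ⟧
toUV-numerator i = Series.trans (toUV-cong (Series.sym (⟦numeratorᴸ⟧ i)))
                           (toUV-⟦⟧ (numeratorᴸ i) (numeratorᴸ-balanced i))

toUV-denom≈1 : ∀ j → toUV (denom (suc j)) ≈[ j ] 1S
toUV-denom≈1 j = ≈[]-trans (≈⇒≈[] (toUV-denom j))
  (≈[]-trans (⟦⟧-≈[]-leading _ _ (ℕ.≤-refl ∷ j≤ (suc j) ∷ [])) (≈⇒≈[] ⟦oneᴸ⟧))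
  where
  j≤ : ∀ m → j ≤ suc j ℕ.+ m
  j≤ m = ℕ.≤-trans (ℕ.n≤1+n j) (ℕ.m≤m+n (suc j) m)

toUV-numerator≈1 : ∀ j → toUV (numerator (suc j)) ≈[ j ] 1S
toUV-numerator≈1 j = ≈[]-trans (≈⇒≈[] (toUV-numerator (suc j)))
  (≈[]-trans (⟦⟧-≈[]-leading _ _ (ℕ.n≤1+n j ∷ j≤ 0 ∷ j≤ (suc j) ∷ []))
             (≈⇒≈[] ⟦oneᴸ⟧))
  where
  j≤ : ∀ m → j ≤ suc j ℕ.+ m
  j≤ m = ℕ.≤-trans (ℕ.n≤1+n j) (ℕ.m≤m+n (suc j) m)

toUV-factor*denom : ∀ j → (toUV (factor (suc j)) *S toUV (denom (suc j))) Series.≈ toUV (numerator (suc j))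
toUV-factor*denom j =
  Series.trans (Series.sym (toUV-* (factor (suc j)) (denom (suc j)) (factor-bounded j) (denom-bounded j)))
          (toUV-cong (factor-*S-denom j))

toUV-factor≈1 : ∀ j → toUV (factor (suc j)) ≈[ j ] 1S
toUV-factor≈1 j = *S-cancelʳ-≈[] (toUV (factor (suc j))) 1S (toUV (denom (suc j))) (denom-constant j 0)
  (≈[]-trans (≈⇒≈[] (toUV-factor*denom j))
  (≈[]-trans (toUV-numerator≈1 j)
  (≈[]-trans (≈[]-sym (toUV-denom≈1 j))
             (≈⇒≈[] (Series.sym (Series.*-identityˡ (toUV (denom (suc j)))))))))

toUV-prodTo-stable : ∀ N n → N ≤ n → toUV (prodTo n) ≈[ N ] toUV (prodTo N)
toUV-prodTo-stable N n N≤n with ℕ.m≤n⇒∃[o]m+o≡n N≤n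
... | k , refl rewrite ℕ.+-comm N k = extra k
  where
  extra : ∀ k → toUV (prodTo (k ℕ.+ N)) ≈[ N ] toUV (prodTo N)
  extra zero    = λ _ _ _ → refl
  extra (suc k) =
    ≈[]-trans (≈⇒≈[] (toUV-* (prodTo (k ℕ.+ N)) (factor (suc (k ℕ.+ N)))
                             (prodTo-bounded (k ℕ.+ N)) (factor-bounded (k ℕ.+ N))))
    (≈[]-trans (*S-cong-≈[] (extra k) (≈[]-weaken (ℕ.m≤n+m N k) (toUV-factor≈1 (k ℕ.+ N))))
               (≈⇒≈[] (Series.*-identityʳ (toUV (prodTo N)))))

denominatorsᴸ : ℕ → List Monomial
denominatorsᴸ zero    = oneᴸ
denominatorsᴸ (suc n) = mul (denominatorsᴸ n) (map uvMonomial (denomᴸ (suc n)))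

numeratorsᴸ : ℕ → List Monomial
numeratorsᴸ zero    = oneᴸ
numeratorsᴸ (suc n) = mul (numeratorsᴸ n) (map uvMonomial (numeratorᴸ (suc n)))

toUV-prodTo-*S-denominators : ∀ n → (toUV (prodTo n) *S ⟦ denominatorsᴸ n ⟧) Series.≈ ⟦ numeratorsᴸ n ⟧
toUV-prodTo-*S-denominators zero = begin
  toUV 1S *S ⟦ oneᴸ ⟧ ≈⟨ Series.*-cong {toUV 1S} {1S} {⟦ oneᴸ ⟧} {⟦ oneᴸ ⟧} toUV-1S Series.refl ⟩
  1S *S ⟦ oneᴸ ⟧      ≈⟨ Series.*-identityˡ ⟦ oneᴸ ⟧ ⟩
  ⟦ oneᴸ ⟧            ∎
  where open SetoidReasoning Series.setoid
toUV-prodTo-*S-denominators (suc n) = begin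
  toUV (P *S F) *S ⟦ mul Dᴸ (map uvMonomial (denomᴸ i)) ⟧
    ≈⟨ Series.*-cong {toUV (P *S F)} {toUV P *S toUV F} (toUV-* P F (prodTo-bounded n) (factor-bounded n))
                (Series.trans (⟦mul⟧ Dᴸ _) (Series.*-congˡ {⟦ Dᴸ ⟧} (Series.sym (toUV-denom n)))) ⟩
  (toUV P *S toUV F) *S (⟦ Dᴸ ⟧ *S toUV (denom i))
    ≈⟨ interchange (toUV P) (toUV F) ⟦ Dᴸ ⟧ (toUV (denom i)) ⟩
  (toUV P *S ⟦ Dᴸ ⟧) *S (toUV F *S toUV (denom i))
    ≈⟨ Series.*-cong {toUV P *S ⟦ Dᴸ ⟧} {⟦ numeratorsᴸ n ⟧}
                (toUV-prodTo-*S-denominators n) (toUV-factor*denom n) ⟩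
  ⟦ numeratorsᴸ n ⟧ *S toUV (numerator i)
    ≈⟨ Series.*-congˡ {⟦ numeratorsᴸ n ⟧} (toUV-numerator i) ⟩
  ⟦ numeratorsᴸ n ⟧ *S ⟦ map uvMonomial (numeratorᴸ i) ⟧
    ≈⟨ Series.sym (⟦mul⟧ (numeratorsᴸ n) _) ⟩
  ⟦ numeratorsᴸ (suc n) ⟧ ∎
  where
  open SetoidReasoning Series.setoid
  i : ℕ
  i = suc n
  P F : Series
  P = prodTo n
  F = factor i
  Dᴸ : List Monomial
  Dᴸ = denominatorsᴸ n

-- The product modulo u^6
triangle : ℕ → ℕ
triangle zero    = 0
triangle (suc x) = triangle x ℕ.+ suc x

-- (c₀ , c₁ , c₂) stands for x ↦ c₀ + c₁ x + c₂ x(x+1)/2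
Quadratic : Set
Quadratic = ℤ × ℤ × ℤ

eval : Quadratic → ℕ → ℤ
eval (c₀ , c₁ , c₂) x = c₀ ℤ.+ c₁ ℤ.* + x ℤ.+ c₂ ℤ.* + triangle x

infixl 6 _+Q_
infixl 7 _·Q_

0Q : Quadratic
0Q = (+ 0 , + 0 , + 0)

_+Q_ : Quadratic → Quadratic → Quadratic
(a₀ , a₁ , a₂) +Q (b₀ , b₁ , b₂) = (a₀ ℤ.+ b₀ , a₁ ℤ.+ b₁ , a₂ ℤ.+ b₂)

_·Q_ : ℤ → Quadratic → Quadratic
c ·Q (a₀ , a₁ , a₂) = (c ℤ.* a₀ , c ℤ.* a₁ , c ℤ.* a₂)

shift : Quadratic → Quadratic
shift (c₀ , c₁ , c₂) = (c₀ ℤ.+ c₁ ℤ.+ c₂ , c₁ ℤ.+ c₂ , c₂)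

shiftⁿ : ℕ → Quadratic → Quadratic
shiftⁿ zero    q = q
shiftⁿ (suc k) q = shiftⁿ k (shift q)

eval-+Q : ∀ p q x → eval (p +Q q) x ≡ eval p x ℤ.+ eval q x
eval-+Q (a₀ , a₁ , a₂) (b₀ , b₁ , b₂) x = lemma a₀ a₁ a₂ b₀ b₁ b₂ (+ x) (+ triangle x)
  where
  lemma : ∀ a₀ a₁ a₂ b₀ b₁ b₂ x t →
          (a₀ ℤ.+ b₀) ℤ.+ (a₁ ℤ.+ b₁) ℤ.* x ℤ.+ (a₂ ℤ.+ b₂) ℤ.* t
          ≡ (a₀ ℤ.+ a₁ ℤ.* x ℤ.+ a₂ ℤ.* t) ℤ.+ (b₀ ℤ.+ b₁ ℤ.* x ℤ.+ b₂ ℤ.* t)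
  lemma = solve-∀

eval-·Q : ∀ c q x → eval (c ·Q q) x ≡ c ℤ.* eval q x
eval-·Q c (a₀ , a₁ , a₂) x = lemma c a₀ a₁ a₂ (+ x) (+ triangle x)
  where
  lemma : ∀ c a₀ a₁ a₂ x t →
          c ℤ.* a₀ ℤ.+ c ℤ.* a₁ ℤ.* x ℤ.+ c ℤ.* a₂ ℤ.* t
          ≡ c ℤ.* (a₀ ℤ.+ a₁ ℤ.* x ℤ.+ a₂ ℤ.* t)
  lemma = solve-∀

eval-shift : ∀ q x → eval (shift q) x ≡ eval q (suc x)
eval-shift (c₀ , c₁ , c₂) x = lemma c₀ c₁ c₂ (+ x) (+ triangle x)
  where
  lemma : ∀ c₀ c₁ c₂ x t →
          (c₀ ℤ.+ c₁ ℤ.+ c₂) ℤ.+ (c₁ ℤ.+ c₂) ℤ.* x ℤ.+ c₂ ℤ.* t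
          ≡ c₀ ℤ.+ c₁ ℤ.* (+ 1 ℤ.+ x) ℤ.+ c₂ ℤ.* (t ℤ.+ (+ 1 ℤ.+ x))
  lemma = solve-∀

eval-shiftⁿ : ∀ k q x → eval (shiftⁿ k q) x ≡ eval q (k ℕ.+ x)
eval-shiftⁿ zero    q x = refl
eval-shiftⁿ (suc k) q x = trans (eval-shiftⁿ k (shift q) x) (eval-shift q (k ℕ.+ x))

quadraticPart : ℕ → Quadratic
quadraticPart 0 = (+ 1 , + 0 , + 0)
quadraticPart 1 = (- + 1 , + 0 , + 0)
quadraticPart 2 = (- + 7 , - + 1 , + 0)
quadraticPart 3 = (+ 7 , + 1 , + 0)
quadraticPart 4 = (+ 27 , + 7 , + 1)
quadraticPart 5 = (- + 27 , - + 7 , - + 1)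
quadraticPart _ = 0Q

initialPart : ℕ → ℕ → ℤ
initialPart 0 0 = + 1
initialPart 0 1 = + 1
initialPart 0 2 = + 1
initialPart 0 3 = + 1
initialPart 0 4 = + 1
initialPart 1 0 = - + 2
initialPart 1 1 = - + 1
initialPart 1 2 = - + 1
initialPart 1 3 = - + 1
initialPart 1 4 = - + 1
initialPart 2 0 = - + 2
initialPart 2 1 = - + 4
initialPart 2 2 = - + 4
initialPart 2 3 = - + 5
initialPart 2 4 = - + 6
initialPart 3 0 = + 4
initialPart 3 1 = + 3
initialPart 3 2 = + 3
initialPart 3 3 = + 5
initialPart 3 4 = + 6
initialPart 4 0 = + 2
initialPart 4 1 = + 6
initialPart 4 2 = + 9
initialPart 4 3 = + 13
initialPart 4 4 = + 20
initialPart 5 0 = + 0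
initialPart 5 1 = - + 4
initialPart 5 2 = - + 8
initialPart 5 3 = - + 14
initialPart 5 4 = - + 21
initialPart _ _ = + 0

-- The coefficient of u^d v^e (d ≤ 5) in toUV (prodTo 6), obtained by expanding the product;
-- for e ≥ 5 it is quadratic in e.
closedForm : Series
closedForm d (suc (suc (suc (suc (suc x))))) = eval (quadraticPart d) x
closedForm d e                               = initialPart d e

lowDenominators : List Monomial
lowDenominators = truncate 6 (denominatorsᴸ 6)

lowNumerators : List Monomial
lowNumerators = truncate 6 (numeratorsᴸ 6)

toUV-prodTo-*S-lowDenominators : (toUV (prodTo 6) *S ⟦ lowDenominators ⟧) ≈[ 6 ] ⟦ lowNumerators ⟧
toUV-prodTo-*S-lowDenominators =
  ≈[]-trans (*S-cong-≈[] {toUV (prodTo 6)} (λ _ _ _ → refl) (≈[]-sym (truncate-≈[] 6 (denominatorsᴸ 6))))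
  (≈[]-trans (≈⇒≈[] (toUV-prodTo-*S-denominators 6)) (truncate-≈[] 6 (numeratorsᴸ 6)))

quadraticProduct : ℕ → List Monomial → ℕ → Quadratic
quadraticProduct B []                d = 0Q
quadraticProduct B ((a , b , c) ∷ p) d =
  if a ≤ᵇ d then c ·Q shiftⁿ (B ∸ b) (quadraticPart (d ∸ a)) +Q quadraticProduct B p d
            else quadraticProduct B p d

multiply-closedForm : ∀ B p d x → All (λ m → proj₁ (proj₂ m) ≤ B) p →
                      multiply p closedForm d (5 ℕ.+ B ℕ.+ x) ≡ eval (quadraticProduct B p d) x
multiply-closedForm B []                d x []          = refl
multiply-closedForm B ((a , b , c) ∷ p) d x (b≤B ∷ low)
  with b ≤ᵇ 5 ℕ.+ B ℕ.+ x | ≤ᵇ-reflects b (5 ℕ.+ B ℕ.+ x)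
... | false | ofⁿ b≰e =
  ⊥-elim (b≰e (ℕ.≤-trans b≤B (ℕ.≤-trans (ℕ.m≤n+m B 5) (ℕ.m≤m+n (5 ℕ.+ B) x))))
... | true  | _ with a ≤ᵇ d
...   | false = trans (ℤ.+-identityˡ _) (multiply-closedForm B p d x low)
...   | true  = begin
  c ℤ.* closedForm (d ∸ a) (5 ℕ.+ B ℕ.+ x ∸ b) ℤ.+ multiply p closedForm d (5 ℕ.+ B ℕ.+ x)
    ≡⟨ cong₂ (λ y z → c ℤ.* closedForm (d ∸ a) y ℤ.+ z) e∸b≡5+y
             (multiply-closedForm B p d x low) ⟩
  c ℤ.* eval (quadraticPart (d ∸ a)) ((B ∸ b) ℕ.+ x) ℤ.+ eval (quadraticProduct B p d) x
    ≡⟨ cong (λ y → c ℤ.* y ℤ.+ eval (quadraticProduct B p d) x)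
            (sym (eval-shiftⁿ (B ∸ b) (quadraticPart (d ∸ a)) x)) ⟩
  c ℤ.* eval q x ℤ.+ eval (quadraticProduct B p d) x
    ≡⟨ cong (ℤ._+ eval (quadraticProduct B p d) x) (sym (eval-·Q c q x)) ⟩
  eval (c ·Q q) x ℤ.+ eval (quadraticProduct B p d) x
    ≡⟨ sym (eval-+Q (c ·Q q) (quadraticProduct B p d) x) ⟩
  eval (c ·Q q +Q quadraticProduct B p d) x ∎
  where
  open ≡-Reasoning
  q : Quadratic
  q = shiftⁿ (B ∸ b) (quadraticPart (d ∸ a))
  e∸b≡5+y : 5 ℕ.+ B ℕ.+ x ∸ b ≡ 5 ℕ.+ ((B ∸ b) ℕ.+ x)
  e∸b≡5+y = begin
    5 ℕ.+ B ℕ.+ x ∸ b     ≡⟨ ℕ.+-∸-comm x (ℕ.≤-trans b≤B (ℕ.m≤n+m B 5)) ⟩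
    5 ℕ.+ B ∸ b ℕ.+ x     ≡⟨ cong (ℕ._+ x) (ℕ.+-∸-assoc 5 b≤B) ⟩
    5 ℕ.+ (B ∸ b) ℕ.+ x   ≡⟨ ℕ.+-assoc 5 (B ∸ b) x ⟩
    5 ℕ.+ ((B ∸ b) ℕ.+ x) ∎

lowDenominators-vDegree≤3 : All (λ m → proj₁ (proj₂ m) ≤ 3) lowDenominators
lowDenominators-vDegree≤3 = toWitness {a? = all? (λ m → proj₁ (proj₂ m) ℕ.≤? 3) lowDenominators} _

multiply-closedForm-initial : ∀ (d : Fin 6) (e : Fin 8) →
  multiply lowDenominators closedForm (toℕ d) (toℕ e) ≡ ⟦ lowNumerators ⟧ (toℕ d) (toℕ e)
multiply-closedForm-initial = toWitness {a? = Fin.all? λ d → Fin.all? λ e →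
  multiply lowDenominators closedForm (toℕ d) (toℕ e) ℤ.≟ ⟦ lowNumerators ⟧ (toℕ d) (toℕ e)} _

eval-quadraticProduct-lowDenominators : ∀ d → d < 6 → ∀ x →
  eval (quadraticProduct 3 lowDenominators d) x ≡ ⟦ lowNumerators ⟧ d (8 ℕ.+ x)
eval-quadraticProduct-lowDenominators 0 _ x = refl
eval-quadraticProduct-lowDenominators 1 _ x = refl
eval-quadraticProduct-lowDenominators 2 _ x = refl
eval-quadraticProduct-lowDenominators 3 _ x = refl
eval-quadraticProduct-lowDenominators 4 _ x = refl
eval-quadraticProduct-lowDenominators 5 _ x = refl
eval-quadraticProduct-lowDenominators (suc (suc (suc (suc (suc (suc _))))))
  (s≤s (s≤s (s≤s (s≤s (s≤s (s≤s ())))))) _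

-- For e ≥ 8 every term reads closedForm in its quadratic range (the monomials of
-- lowDenominators have v-degree ≤ 3), so the check becomes an identity of quadratics.
closedForm-*S-lowDenominators : (closedForm *S ⟦ lowDenominators ⟧) ≈[ 6 ] ⟦ lowNumerators ⟧
closedForm-*S-lowDenominators d e d<6 =
  trans (Series.*-comm closedForm ⟦ lowDenominators ⟧ d e)
        (trans (⟦⟧-*S lowDenominators closedForm d e) (byRange e))
  where
  byRange : ∀ e → multiply lowDenominators closedForm d e ≡ ⟦ lowNumerators ⟧ d e
  byRange e with e ℕ.<? 8
  ... | yes e<8 = subst₂ (λ d e → multiply lowDenominators closedForm d e ≡ ⟦ lowNumerators ⟧ d e)
                         (Fin.toℕ-fromℕ< d<6) (Fin.toℕ-fromℕ< e<8)
                         (multiply-closedForm-initial (fromℕ< d<6) (fromℕ< e<8))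
  ... | no  e≮8 with ℕ.m≤n⇒∃[o]m+o≡n (ℕ.≮⇒≥ e≮8)
  ...   | x , refl = trans (multiply-closedForm 3 lowDenominators d x lowDenominators-vDegree≤3)
                           (eval-quadraticProduct-lowDenominators d d<6 x)

toUV-prodTo≈closedForm : ∀ n → 6 ≤ n → toUV (prodTo n) ≈[ 6 ] closedForm
toUV-prodTo≈closedForm n 6≤n = ≈[]-trans (toUV-prodTo-stable 6 n 6≤n)
  (*S-cancelʳ-≈[] (toUV (prodTo 6)) closedForm ⟦ lowDenominators ⟧ refl
    (≈[]-trans toUV-prodTo-*S-lowDenominators (≈[]-sym closedForm-*S-lowDenominators)))

-- Coefficients of P̃_n
constS-*S : ∀ p B m k → (constS p *S B) m k ≡ (p *P B m) k
constS-*S p B m k = begin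
  (constS p *S B) m k
    ≡⟨ sumℤ-head m _ ⟩
  (p *P B m) k ℤ.+ sumℤ m (λ j → (0P *P B (m ∸ suc j)) k)
    ≡⟨ cong (λ s → (p *P B m) k ℤ.+ s) (sumℤ-zero m λ j _ → Poly.zeroˡ (B (m ∸ suc j)) k) ⟩
  (p *P B m) k ℤ.+ + 0
    ≡⟨ ℤ.+-identityʳ _ ⟩
  (p *P B m) k ∎
  where open ≡-Reasoning

*P-X-2 : ∀ q k → ((XP -P (1P +P 1P)) *P q) (suc k) ≡ q k ℤ.- + 2 ℤ.* q (suc k)
*P-X-2 q k = begin
  ((XP -P (1P +P 1P)) *P q) (suc k)
    ≡⟨ sumℤ-head (suc k) _ ⟩
  - + 2 ℤ.* q (suc k) ℤ.+ sumℤ (suc k) (λ j → (XP -P (1P +P 1P)) (suc j) ℤ.* q (k ∸ j))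
    ≡⟨ cong (λ s → - + 2 ℤ.* q (suc k) ℤ.+ s) (sumℤ-head k _) ⟩
  - + 2 ℤ.* q (suc k) ℤ.+ (+ 1 ℤ.* q k ℤ.+ sumℤ k (λ _ → + 0))
    ≡⟨ cong (λ s → - + 2 ℤ.* q (suc k) ℤ.+ (+ 1 ℤ.* q k ℤ.+ s)) (sumℤ-zero k λ _ _ → refl) ⟩
  - + 2 ℤ.* q (suc k) ℤ.+ (+ 1 ℤ.* q k ℤ.+ + 0)
    ≡⟨ rearrange (q k) (q (suc k)) ⟩
  q k ℤ.- + 2 ℤ.* q (suc k) ∎
  where
  open ≡-Reasoning
  rearrange : ∀ a b → - + 2 ℤ.* b ℤ.+ (+ 1 ℤ.* a ℤ.+ + 0) ≡ a ℤ.- + 2 ℤ.* b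
  rearrange = solve-∀

n<2^n : ∀ n → n < 2 ^ n
n<2^n zero    = s≤s z≤n
n<2^n (suc n) = begin-strict
  suc n               <⟨ s≤s (n<2^n n) ⟩
  suc (2 ^ n)         ≤⟨ ℕ.+-monoˡ-≤ (2 ^ n) (ℕ.m^n>0 2 n) ⟩
  2 ^ n ℕ.+ 2 ^ n     ≡⟨ cong (2 ^ n ℕ.+_) (sym (ℕ.+-identityʳ (2 ^ n))) ⟩
  2 ^ suc n           ∎
  where open ℕ.≤-Reasoning

-- f 0 = 2^m f m for every m, so 2^m divides f 0 for all m.
twice-next⇒zero : ∀ (f : ℕ → ℤ) → (∀ k → f k ≡ + 2 ℤ.* f (suc k)) → ∀ k → f k ≡ + 0
twice-next⇒zero f double k = head-zero (λ j → f (j ℕ.+ k)) (λ j → double (j ℕ.+ k))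
  where
  head-zero : ∀ (g : ℕ → ℤ) → (∀ k → g k ≡ + 2 ℤ.* g (suc k)) → g 0 ≡ + 0
  head-zero g double-g = ℤ.∣i∣≡0⇒i≡0 ∣g0∣≡0
    where
    scaled : ∀ m → ∣ g 0 ∣ ≡ 2 ^ m ℕ.* ∣ g m ∣
    scaled zero    = sym (ℕ.*-identityˡ ∣ g 0 ∣)
    scaled (suc m) = begin
      ∣ g 0 ∣                         ≡⟨ scaled m ⟩
      2 ^ m ℕ.* ∣ g m ∣               ≡⟨ cong (λ z → 2 ^ m ℕ.* ∣ z ∣) (double-g m) ⟩
      2 ^ m ℕ.* ∣ + 2 ℤ.* g (suc m) ∣ ≡⟨ cong (2 ^ m ℕ.*_) (ℤ.abs-* (+ 2) (g (suc m))) ⟩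
      2 ^ m ℕ.* (2 ℕ.* ∣ g (suc m) ∣) ≡⟨ regroup (2 ^ m) ∣ g (suc m) ∣ ⟩
      2 ^ suc m ℕ.* ∣ g (suc m) ∣     ∎
      where
      open ≡-Reasoning
      regroup : ∀ a b → a ℕ.* (2 ℕ.* b) ≡ 2 ℕ.* a ℕ.* b
      regroup = ℕ-Solver.solve-∀

    a : ℕ
    a = ∣ g 0 ∣

    ∣g0∣≡0 : a ≡ 0
    ∣g0∣≡0 with ∣ g a ∣ in ∣ga∣≡b
    ... | zero  = trans (scaled a) (trans (cong (2 ^ a ℕ.*_) ∣ga∣≡b) (ℕ.*-zeroʳ (2 ^ a)))
    ... | suc b = ⊥-elim (ℕ.<⇒≱ (n<2^n a) (subst (2 ^ a ≤_) 2^a*[1+b]≡a (ℕ.m≤m*n (2 ^ a) (suc b))))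
      where
      2^a*[1+b]≡a : 2 ^ a ℕ.* suc b ≡ a
      2^a*[1+b]≡a = sym (trans (scaled a) (cong (2 ^ a ℕ.*_) ∣ga∣≡b))

module _ (P : ℕ → Poly) (isP : IsPtilde P) where

  -- the coefficient of t^(n+1) X^(k+1) in the defining identity
  Ptilde-recursion : ∀ n k → P (suc n) k ≡ infProd (suc n) (suc k) ℤ.+ + 2 ℤ.* P (suc n) (suc k)
  Ptilde-recursion n k = begin
    P (suc n) k                                               ≡⟨ rearrange (P (suc n) k) (P (suc n) (suc k)) ⟩
    (P (suc n) k ℤ.- + 2 ℤ.* P (suc n) (suc k)) ℤ.+ + 2 ℤ.* P (suc n) (suc k)
      ≡⟨ cong (ℤ._+ + 2 ℤ.* P (suc n) (suc k)) (trans (sym (*P-X-2 (P (suc n)) k)) lhs≡) ⟩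
    infProd (suc n) (suc k) ℤ.+ + 2 ℤ.* P (suc n) (suc k)    ∎
    where
    open ≡-Reasoning
    rearrange : ∀ a b → a ≡ (a ℤ.- + 2 ℤ.* b) ℤ.+ + 2 ℤ.* b
    rearrange = solve-∀
    lhs≡ : ((XP -P (1P +P 1P)) *P P (suc n)) (suc k) ≡ infProd (suc n) (suc k)
    lhs≡ = trans (sym (trans (ℤ.+-identityˡ _) (constS-*S (XP -P (1P +P 1P)) (genS P) (suc n) (suc k))))
                 (isP (suc n) (suc k))

  Ptilde-vanishes : ∀ n j → P (suc n) (j ℕ.+ suc n) ≡ + 0
  Ptilde-vanishes n = twice-next⇒zero (λ j → P (suc n) (j ℕ.+ suc n)) λ j → begin
    P (suc n) (j ℕ.+ suc n)
      ≡⟨ Ptilde-recursion n (j ℕ.+ suc n) ⟩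
    infProd (suc n) (suc j ℕ.+ suc n) ℤ.+ + 2 ℤ.* P (suc n) (suc j ℕ.+ suc n)
      ≡⟨ cong (ℤ._+ + 2 ℤ.* P (suc n) (suc j ℕ.+ suc n))
              (prodTo-bounded (suc n) (suc n) (suc j ℕ.+ suc n) (s≤s (ℕ.m≤n+m (suc n) j))) ⟩
    + 0 ℤ.+ + 2 ℤ.* P (suc n) (suc j ℕ.+ suc n)
      ≡⟨ ℤ.+-identityˡ _ ⟩
    + 2 ℤ.* P (suc n) (suc j ℕ.+ suc n) ∎
    where open ≡-Reasoning

triangle-formula : ∀ y → (suc y ℕ.* y) / 2 ≡ triangle y
triangle-formula y = trans (cong (_/ 2) (sym (double y))) (m*n/n≡m (triangle y) 2)
  where
  double : ∀ y → triangle y ℕ.* 2 ≡ suc y ℕ.* y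
  double zero    = refl
  double (suc y) = begin
    (triangle y ℕ.+ suc y) ℕ.* 2      ≡⟨ ℕ.*-distribʳ-+ 2 (triangle y) (suc y) ⟩
    triangle y ℕ.* 2 ℕ.+ suc y ℕ.* 2  ≡⟨ cong (ℕ._+ suc y ℕ.* 2) (double y) ⟩
    suc y ℕ.* y ℕ.+ suc y ℕ.* 2       ≡⟨ regroup y ⟩
    suc (suc y) ℕ.* suc y             ∎
    where
    open ≡-Reasoning
    regroup : ∀ y → suc y ℕ.* y ℕ.+ suc y ℕ.* 2 ≡ suc (suc y) ℕ.* suc y
    regroup = ℕ-Solver.solve-∀

triangle-eval : ∀ k x → + triangle (k ℕ.+ x) ≡ eval (shiftⁿ k (+ 0 , + 0 , + 1)) x
triangle-eval k x = begin
  + triangle (k ℕ.+ x)                          ≡⟨ sym (ℤ.*-identityˡ _) ⟩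
  + 1 ℤ.* + triangle (k ℕ.+ x)                  ≡⟨ sym (ℤ.+-identityˡ _) ⟩
  eval (+ 0 , + 0 , + 1) (k ℕ.+ x)              ≡⟨ sym (eval-shiftⁿ k (+ 0 , + 0 , + 1) x) ⟩
  eval (shiftⁿ k (+ 0 , + 0 , + 1)) x           ∎
  where open ≡-Reasoning

infProd-nearDiagonal : ∀ x d → d ≤ 5 →
  infProd (10 ℕ.+ x) ((10 ∸ d) ℕ.+ x) ≡ eval (shiftⁿ (5 ∸ d) (quadraticPart d)) x
infProd-nearDiagonal x d d≤5 = begin
  prodTo n n e                              ≡⟨ cong (λ m → prodTo n m e) (sym d+e≡n) ⟩
  toUV (prodTo n) d e                       ≡⟨ toUV-prodTo≈closedForm n 6≤n d e (s≤s d≤5) ⟩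
  closedForm d e                            ≡⟨ cong (closedForm d) e≡5+y ⟩
  eval (quadraticPart d) ((5 ∸ d) ℕ.+ x)    ≡⟨ sym (eval-shiftⁿ (5 ∸ d) (quadraticPart d) x) ⟩
  eval (shiftⁿ (5 ∸ d) (quadraticPart d)) x ∎
  where
  open ≡-Reasoning
  n e : ℕ
  n = 10 ℕ.+ x
  e = (10 ∸ d) ℕ.+ x
  6≤n : 6 ≤ n
  6≤n = ℕ.≤-trans (ℕ.m≤m+n 6 4) (ℕ.m≤m+n 10 x)
  d+e≡n : d ℕ.+ e ≡ n
  d+e≡n = trans (sym (ℕ.+-assoc d (10 ∸ d) x))
                (cong (ℕ._+ x) (ℕ.m+[n∸m]≡n (ℕ.≤-trans d≤5 (ℕ.m≤m+n 5 5))))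
  e≡5+y : e ≡ 5 ℕ.+ ((5 ∸ d) ℕ.+ x)
  e≡5+y = trans (cong (ℕ._+ x) (ℕ.+-∸-assoc 5 d≤5)) (ℕ.+-assoc 5 (5 ∸ d) x)

TopCoefficients : (ℕ → Poly) → ℕ → Set
TopCoefficients P n =
  (P n (n ∸ 1) ≡ + 1)
  × (P n (n ∸ 2) ≡ + 1)
  × (P n (n ∸ 3) ≡ - (+ (n ∸ 2)))
  × (P n (n ∸ 4) ≡ - (+ (n ∸ 3)))
  × (P n (n ∸ 5) ≡ + (((n ∸ 3) Data.Nat.* (n ∸ 4)) / 2))
  × (P n (n ∸ 6) ≡ + (((n ∸ 4) Data.Nat.* (n ∸ 5)) / 2))
  × (∀ j → P n (n Data.Nat.+ j) ≡ + 0)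

module _ (P : ℕ → Poly) (isP : IsPtilde P) (x : ℕ) where

  Ptilde-step : ∀ d {v w} → d ≤ 5 → P (10 ℕ.+ x) ((10 ∸ d) ℕ.+ x) ≡ v →
                eval (shiftⁿ (5 ∸ d) (quadraticPart d)) x ℤ.+ + 2 ℤ.* v ≡ w →
                P (10 ℕ.+ x) ((9 ∸ d) ℕ.+ x) ≡ w
  Ptilde-step d {v} {w} d≤5 previous step = begin
    P n ((9 ∸ d) ℕ.+ x)
      ≡⟨ Ptilde-recursion P isP (9 ℕ.+ x) ((9 ∸ d) ℕ.+ x) ⟩
    infProd n (suc ((9 ∸ d) ℕ.+ x)) ℤ.+ + 2 ℤ.* P n (suc ((9 ∸ d) ℕ.+ x))
      ≡⟨ cong (λ e → infProd n e ℤ.+ + 2 ℤ.* P n e) 1+e≡ ⟩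
    infProd n ((10 ∸ d) ℕ.+ x) ℤ.+ + 2 ℤ.* P n ((10 ∸ d) ℕ.+ x)
      ≡⟨ cong₂ (λ a b → a ℤ.+ + 2 ℤ.* b) (infProd-nearDiagonal x d d≤5) previous ⟩
    eval (shiftⁿ (5 ∸ d) (quadraticPart d)) x ℤ.+ + 2 ℤ.* v
      ≡⟨ step ⟩
    w ∎
    where
    open ≡-Reasoning
    n : ℕ
    n = 10 ℕ.+ x
    1+e≡ : suc ((9 ∸ d) ℕ.+ x) ≡ (10 ∸ d) ℕ.+ x
    1+e≡ = cong (ℕ._+ x) (sym (ℕ.+-∸-assoc 1 (ℕ.≤-trans d≤5 (ℕ.m≤m+n 5 4))))

  Ptilde-topCoefficients : TopCoefficients P (10 ℕ.+ x)
  Ptilde-topCoefficients =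
    c₁ , c₂ , c₃ , c₄ , trans c₅ (halved 6 3 refl refl) , trans c₆ (halved 5 4 refl refl) ,
    λ j → trans (cong (P (10 ℕ.+ x)) (ℕ.+-comm (10 ℕ.+ x) j)) (Ptilde-vanishes P isP (9 ℕ.+ x) j)
    where
    -- Each left-hand side is eval (shiftⁿ (5 ∸ d) (quadraticPart d)) x + 2 · (previous value).
    X T : ℤ
    X = + x
    T = + triangle x

    c₁ : P (10 ℕ.+ x) (9 ℕ.+ x) ≡ + 1
    c₁ = Ptilde-step 0 z≤n (Ptilde-vanishes P isP (9 ℕ.+ x) 0) refl

    c₂ : P (10 ℕ.+ x) (8 ℕ.+ x) ≡ + 1
    c₂ = Ptilde-step 1 (s≤s z≤n) c₁ refl

    c₃ : P (10 ℕ.+ x) (7 ℕ.+ x) ≡ - (+ 8 ℤ.+ X)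
    c₃ = Ptilde-step 2 (s≤s (s≤s z≤n)) c₂ (step X T)
      where
      step : ∀ X T → (- + 10 ℤ.+ - + 1 ℤ.* X ℤ.+ + 0 ℤ.* T) ℤ.+ + 2 ℤ.* + 1 ≡ - (+ 8 ℤ.+ X)
      step = solve-∀

    c₄ : P (10 ℕ.+ x) (6 ℕ.+ x) ≡ - (+ 7 ℤ.+ X)
    c₄ = Ptilde-step 3 (s≤s (s≤s (s≤s z≤n))) c₃ (step X T)
      where
      step : ∀ X T → (+ 9 ℤ.+ + 1 ℤ.* X ℤ.+ + 0 ℤ.* T) ℤ.+ + 2 ℤ.* - (+ 8 ℤ.+ X) ≡ - (+ 7 ℤ.+ X)
      step = solve-∀

    c₅ : P (10 ℕ.+ x) (5 ℕ.+ x) ≡ eval (shiftⁿ 6 (+ 0 , + 0 , + 1)) x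
    c₅ = Ptilde-step 4 (s≤s (s≤s (s≤s (s≤s z≤n)))) c₄ (step X T)
      where
      step : ∀ X T → (+ 35 ℤ.+ + 8 ℤ.* X ℤ.+ + 1 ℤ.* T) ℤ.+ + 2 ℤ.* - (+ 7 ℤ.+ X)
                     ≡ + 21 ℤ.+ + 6 ℤ.* X ℤ.+ + 1 ℤ.* T
      step = solve-∀

    c₆ : P (10 ℕ.+ x) (4 ℕ.+ x) ≡ eval (shiftⁿ 5 (+ 0 , + 0 , + 1)) x
    c₆ = Ptilde-step 5 (s≤s (s≤s (s≤s (s≤s (s≤s z≤n))))) c₅ (step X T)
      where
      step : ∀ X T → (- + 27 ℤ.+ - + 7 ℤ.* X ℤ.+ - + 1 ℤ.* T)
                     ℤ.+ + 2 ℤ.* (+ 21 ℤ.+ + 6 ℤ.* X ℤ.+ + 1 ℤ.* T)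
                     ≡ + 15 ℤ.+ + 5 ℤ.* X ℤ.+ + 1 ℤ.* T
      step = solve-∀

    -- The product is matched factor by factor: comparing the quotients directly would make
    -- the type checker unfold the division.
    halved : ∀ k m → suc (k ℕ.+ x) ≡ 10 ℕ.+ x ∸ m → k ℕ.+ x ≡ 10 ℕ.+ x ∸ suc m →
             eval (shiftⁿ k (+ 0 , + 0 , + 1)) x ≡ + (((10 ℕ.+ x ∸ m) ℕ.* (10 ℕ.+ x ∸ suc m)) / 2)
    halved k m e₁ e₂ = trans (sym (triangle-eval k x))
      (cong +_ (trans (sym (triangle-formula (k ℕ.+ x))) (cong (_/ 2) (cong₂ ℕ._*_ e₁ e₂))))

corollary4p2 : (P : ℕ → Poly) → IsPtilde P → (n : ℕ) → 10 ≤ n →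
    (P n (n ∸ 1) ≡ + 1)
    × (P n (n ∸ 2) ≡ + 1)
    × (P n (n ∸ 3) ≡ - (+ (n ∸ 2)))
    × (P n (n ∸ 4) ≡ - (+ (n ∸ 3)))
    × (P n (n ∸ 5) ≡ + (((n ∸ 3) Data.Nat.* (n ∸ 4)) / 2))
    × (P n (n ∸ 6) ≡ + (((n ∸ 4) Data.Nat.* (n ∸ 5)) / 2))
    × (∀ j → P n (n Data.Nat.+ j) ≡ + 0)
corollary4p2 P isP n 10≤n =
  subst (TopCoefficients P) (ℕ.m+[n∸m]≡n 10≤n) (Ptilde-topCoefficients P isP (n ∸ 10))
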